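{- Let $p\equiv 1\pmod 4$ be a prime with $p>5$, and let $D\subseteq\mathbb Z_p$ be the set of quadratic residues. Let $\mathcal B$ be the collection of sets $b\cap D$ for $b$ ranging over the translates $D+g$ ($g\in\mathbb Z_p$) with $b\ne D$. Let $\infty$ be a new point and let $\mathcal B_\infty$ consist of all members of $\mathcal B$ of size $\frac{p-1}{4}$ together with all members of $\mathcal B$ of size $\frac{p-5}{4}$, each modified by adjoining the point $\infty$. Then $(D\cup\{\infty\},\mathcal B_\infty)$ is a $2$-$(\frac{p+1}{2},\frac{p-1}{4},\frac{p-9}{4})$ adesign.
   Context: A $t$-$(v,k,\lambda)$ adesign is an incidence structure with $v$ points and blocks of size $k$ such that every $t$-subset of points lies in exactly $\lambda$ or exactly $\lambda+1$ blocks, both values occurring. -}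

module Defs where

open import Data.Nat using (ℕ; zero; suc; _+_; _*_; _∸_; _≟_; NonZero)
open import Data.Nat.DivMod using (_%_; _/_; m%n<n)
open import Data.Fin using (Fin; toℕ; fromℕ<)
import Data.Fin.Properties as FinP
open import Data.Fin.Subset using (Subset; _⊆_; _∩_; ∣_∣; inside; outside)
open import Data.Fin.Subset.Properties using (_⊆?_)
open import Data.Vec using (Vec; tabulate; lookup; _∷ʳ_)
open import Data.Vec.Properties using (≡-dec)
import Data.Bool as Bool
open import Data.List using (List; []; _∷_; length; filter; allFin)
open import Data.List.Membership.Propositional renaming (_∈_ to _∈L_)
open import Data.Product using (_×_; ∃; Σ-syntax)
open import Data.Sum using (_⊎_)
open import Relation.Nullary using (¬_; Dec; yes; no; _×-dec_; ¬?)
open import Relation.Nullary.Decidable using (⌊_⌋)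
open import Relation.Binary.PropositionalEquality using (_≡_)

-- Points live in a finite ambient type Fin n; the point set is a subset
-- P ⊆ Fin n, and the blocks form a finite list (a multiset) of subsets.
-- λ(T) = number of blocks (with multiplicity) containing T.

blockCount : ∀ {n} → List (Subset n) → Subset n → ℕ
blockCount B T = length (filter (T ⊆?_) B)

record IsAdesign {n : ℕ} (t v k l : ℕ) (P : Subset n) (B : List (Subset n)) : Set where
  field
    numPoints   : ∣ P ∣ ≡ v
    blocksInP   : ∀ b → b ∈L B → b ⊆ P
    blockSize   : ∀ b → b ∈L B → ∣ b ∣ ≡ k
    twoValues   : ∀ T → T ⊆ P → ∣ T ∣ ≡ t →
                  (blockCount B T ≡ l) ⊎ (blockCount B T ≡ suc l)
    lowerOccurs : ∃ λ T → T ⊆ P × ∣ T ∣ ≡ t × blockCount B T ≡ l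
    upperOccurs : ∃ λ T → T ⊆ P × ∣ T ∣ ≡ t × blockCount B T ≡ suc l

-- The field ℤ_p, represented by Fin p with arithmetic mod p.

module _ (p : ℕ) .{{_ : NonZero p}} where

  subₚ : Fin p → Fin p → Fin p
  subₚ x g = fromℕ< (m%n<n (toℕ x + (p ∸ toℕ g)) p)

  IsQR : Fin p → Set
  IsQR x = ¬ (toℕ x ≡ 0) × ∃ λ (y : Fin p) → (toℕ y * toℕ y) % p ≡ toℕ x

  isQR? : (x : Fin p) → Dec (IsQR x)
  isQR? x = ¬? (toℕ x ≟ 0) ×-dec FinP.any? (λ y → (toℕ y * toℕ y) % p ≟ toℕ x)

  QR : Subset p
  QR = tabulate (λ x → ⌊ isQR? x ⌋)

  translate : Fin p → Subset p
  translate g = tabulate (λ x → lookup QR (subₚ x g))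

  -- Ambient point type Fin (suc p): Fin p (embedded via inject₁) together
  -- with the new point ∞ = fromℕ p (the last index).
  -- addInfty c true = c ∪ {∞},  addInfty c false = c.
  addInfty : Subset p → Bool.Bool → Subset (suc p)
  addInfty c b = c ∷ʳ b

  points : Subset (suc p)
  points = addInfty QR inside

  blockOf : Fin p → List (Subset (suc p)) → List (Subset (suc p))
  blockOf g rest with ≡-dec Bool._≟_ (translate g) QR
  ... | yes _ = rest
  ... | no _ with ∣ translate g ∩ QR ∣ ≟ (p ∸ 1) / 4
  ...   | yes _ = addInfty (translate g ∩ QR) outside ∷ rest
  ...   | no _ with ∣ translate g ∩ QR ∣ ≟ (p ∸ 5) / 4
  ...     | yes _ = addInfty (translate g ∩ QR) inside ∷ rest
  ...     | no _ = rest

  blocksInfty : List (Subset (suc p))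
  blocksInfty = Data.List.foldr blockOf [] (allFin p)

module Submission where

-- Let D and N be the residues and nonresidues of ℤ_p and shared a = ∣(D + a) ∩ D∣.
-- Multiplying by a residue preserves D and N, and multiplying by a nonresidue swaps them
-- (it maps D into N, and ∣D∣ = ∣N∣ because squaring is two-to-one on ℤ_p ∖ {0}); hence
-- shared a takes one value A on D and one value B on N, and summing shared over ℤ_p gives
-- ∣D∣² = ∣D∣ (1 + A + B).  For p ≡ 1 (mod 4), ∣D∣ = (p − 1)/2 is even, which forces
-- −1 ∈ D (otherwise A = B); then, for a fixed nonresidue n, counting the nonresidues and
-- the residues x by the class of x − n, resp. x + n, gives B = A + 1, so A = (p − 5)/4 and
-- B = (p − 1)/4.  The block (D + g) ∩ D, with ∞ adjoined when g ∈ D, therefore always has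
-- (p − 1)/4 points; a pair {x, ∞} lies in shared x = A blocks and a pair {x, y} ⊆ D in
-- shared (x − y) − 1 ∈ {A − 1, B − 1} blocks, the −1 discounting the excluded translate g = 0.

open import Defs
open import Algebra.Bundles using (CommutativeRing)
open import Algebra.Structures using (IsCommutativeRing)
open import Algebra.Solver.Ring.AlmostCommutativeRing using (fromCommutativeRing; _-Raw-AlmostCommutative⟶_)
import Algebra.Solver.Ring as Solver
import Algebra.Solver.CommutativeMonoid as CommutativeMonoidSolver
open import Data.Bool using (Bool; true; false; _∧_; _∨_; not)
open import Data.Bool.Properties using (∧-identityʳ; ∧-zeroʳ; ∨-zeroʳ)
import Data.Bool as Bool
open import Data.Empty using (⊥-elim)
open import Data.Fin using (Fin; zero; suc; toℕ; fromℕ<; inject₁; fromℕ; _≟_)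
import Data.Fin.Properties as Finₚ
open import Data.Fin.Permutation using (permutation)
open import Data.Fin.Relation.Unary.Top using (view; ‵fromℕ; ‵inj₁)
open import Data.Fin.Subset using (Subset; _⊆_; _∩_; ∣_∣; ⁅_⁆)
open import Data.Fin.Subset.Properties using (_⊆?_; ∣⁅x⁆∣≡1; x∈⁅x⁆; x∈⁅y⁆⇒x≡y)
open import Data.List using (List; []; _∷_; _++_; length; filter; foldr)
import Data.List as List
import Data.List.Properties as Listₚ
open import Data.Integer using (ℤ)
import Data.Integer as ℤ
import Data.Integer.Properties as ℤₚ
open import Data.Maybe using (Maybe)
import Data.Maybe as Maybe
open import Data.Sign using (Sign)
import Data.Sign as Sign
open import Data.List.Membership.Propositional using () renaming (_∈_ to _∈L_)
open import Data.List.Membership.Propositional.Properties using (∈-++⁻)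
open import Data.List.Relation.Unary.Any using (here)
open import Data.Nat using (ℕ; zero; suc; _+_; _*_; _∸_; _≤_; _<_; z≤n; s≤s; NonZero; >-nonZero; >-nonZero⁻¹; ≢-nonZero; nonTrivial⇒n>1)
import Data.Nat as ℕ
open import Data.Nat.Properties hiding (_≟_)
open import Data.Nat.DivMod
open import Data.Nat.Primality using (Prime; euclidsLemma; prime⇒nonTrivial)
open import Data.Nat.Divisibility using (_∣_; m%n≡0⇒n∣m; n∣m⇒m%n≡0)
open import Data.Nat.Coprimality using (prime⇒coprime; coprime-Bézout)
open import Data.Nat.GCD using (module Bézout)
open import Data.Product using (_×_; _,_; ∃; ∃₂; proj₁; proj₂)
open import Data.Sum using (_⊎_; inj₁; inj₂)
import Data.Sum as Sum
open import Data.Vec using ([]; _∷_; lookup; tabulate; _∷ʳ_; initLast)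
import Data.Vec.Properties as Vecₚ
open import Data.Vec.Properties using (≡-dec)
open import Function using (_∘_; id)
open import Data.Nat.Tactic.RingSolver using (solve-∀)
open import Relation.Binary.PropositionalEquality
open import Relation.Nullary using (¬_; Dec; yes; no; does; dec⇒maybe; ¬?; _×-dec_)
open import Relation.Nullary.Decidable using (map′; dec-true; dec-false; does-⇔; isYes≗does)
open import Function.Bundles using (mk⇔)

open import Algebra.Properties.Semiring.Sum +-*-semiring
  using (sum; sum-cong-≗; sum-replicate-zero; ∑-distrib-+; ∑-comm; ∑-permute; *-distribˡ-sum; *-distribʳ-sum)

𝕀 : Bool → ℕ
𝕀 true  = 1
𝕀 false = 0

𝕀-∧ : ∀ a b → 𝕀 (a ∧ b) ≡ 𝕀 a * 𝕀 b
𝕀-∧ true  b = sym (+-identityʳ (𝕀 b))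
𝕀-∧ false b = refl

𝕀-idem : ∀ a → 𝕀 a * 𝕀 a ≡ 𝕀 a
𝕀-idem true  = refl
𝕀-idem false = refl

𝕀-injective : ∀ {a b} → 𝕀 a ≡ 𝕀 b → a ≡ b
𝕀-injective {true}  {true}  _ = refl
𝕀-injective {false} {false} _ = refl

𝕀-positive : ∀ {b} → 0 < 𝕀 b → b ≡ true
𝕀-positive {true} _ = refl

𝕀-∨-disjoint : ∀ {A B : Set} (a? : Dec A) (b? : Dec B) → ¬ (A × B) →
               𝕀 (does a? ∨ does b?) ≡ 𝕀 (does a?) + 𝕀 (does b?)
𝕀-∨-disjoint (yes a) (yes b) ¬ab = ⊥-elim (¬ab (a , b))
𝕀-∨-disjoint (yes _) (no _)  _   = refl
𝕀-∨-disjoint (no _)  _       _   = refl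

𝕀-+-𝕀-not : ∀ b → 𝕀 b + 𝕀 (not b) ≡ 1
𝕀-+-𝕀-not true  = refl
𝕀-+-𝕀-not false = refl

𝕀*𝕀-positive : ∀ a b → 0 < 𝕀 a * 𝕀 b → a ≡ true × b ≡ true
𝕀*𝕀-positive true true _ = refl , refl

true≢false : true ≢ false
true≢false ()

∧-true⁻ : ∀ a b → a ∧ b ≡ true → a ≡ true × b ≡ true
∧-true⁻ true true _ = refl , refl

bool-ext : ∀ {a b : Bool} → (a ≡ true → b ≡ true) → (b ≡ true → a ≡ true) → a ≡ b
bool-ext {true}  {true}  _ _ = refl
bool-ext {true}  {false} f _ = sym (f refl)
bool-ext {false} {true}  _ g = g refl
bool-ext {false} {false} _ _ = refl

does-true⁻ : ∀ {A : Set} (a? : Dec A) → does a? ≡ true → A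
does-true⁻ (yes a) _ = a

δ : ∀ {n} → Fin n → Fin n → ℕ
δ x a = 𝕀 (does (x ≟ a))

δ-≡ : ∀ {n} {x a : Fin n} → x ≡ a → δ x a ≡ 1
δ-≡ {x = x} {a} e with x ≟ a
... | yes _ = refl
... | no x≢a = ⊥-elim (x≢a e)

δ-≢ : ∀ {n} {x a : Fin n} → x ≢ a → δ x a ≡ 0
δ-≢ {x = x} {a} x≢a with x ≟ a
... | yes e = ⊥-elim (x≢a e)
... | no _ = refl

sum-const : ∀ n c → sum {n} (λ _ → c) ≡ n * c
sum-const zero    c = refl
sum-const (suc n) c = cong (c +_) (sum-const n c)

sum-δ : ∀ {n} (a : Fin n) (f : Fin n → ℕ) → sum (λ x → δ x a * f x) ≡ f a
sum-δ {suc n} zero    f = trans (cong₂ _+_ (+-identityʳ (f zero)) (sum-replicate-zero n)) (+-identityʳ (f zero))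
sum-δ {suc n} (suc a) f = sum-δ a (f ∘ suc)

sum-δ₁ : ∀ {n} (a : Fin n) → sum (λ x → δ x a) ≡ 1
sum-δ₁ a = trans (sum-cong-≗ (λ x → sym (*-identityʳ (δ x a)))) (sum-δ a (λ _ → 1))

sum-mono-≤ : ∀ {n} {f g : Fin n → ℕ} → (∀ i → f i ≤ g i) → sum f ≤ sum g
sum-mono-≤ {zero}  _  = z≤n
sum-mono-≤ {suc n} le = +-mono-≤ (le zero) (sum-mono-≤ (le ∘ suc))

sum-≤-≡⇒≗ : ∀ {n} {f g : Fin n → ℕ} → (∀ i → f i ≤ g i) → sum f ≡ sum g → ∀ i → f i ≡ g i
sum-≤-≡⇒≗ {suc n} {f} {g} le e zero =
  ≤-antisym (le zero) (+-cancelʳ-≤ (sum (g ∘ suc)) (g zero) (f zero)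
    (subst (_≤ f zero + sum (g ∘ suc)) e (+-monoʳ-≤ (f zero) (sum-mono-≤ (le ∘ suc)))))
sum-≤-≡⇒≗ {suc n} {f} {g} le e (suc i) =
  sum-≤-≡⇒≗ (le ∘ suc) (+-cancelˡ-≡ (g zero) _ _ (trans (cong (_+ sum (f ∘ suc)) (sym f₀≡g₀)) e)) i
  where f₀≡g₀ = sum-≤-≡⇒≗ le e zero

sum-positive : ∀ {n} (f : Fin n → ℕ) → 0 < sum f → ∃ λ i → 0 < f i
sum-positive {suc n} f pos with f zero in eq
... | suc _ = zero , subst (0 <_) (sym eq) (s≤s z≤n)
... | zero with sum-positive (f ∘ suc) pos
...   | i , fi>0 = suc i , fi>0

sum-∘-bijection : ∀ {n} (f : Fin n → ℕ) (σ τ : Fin n → Fin n) →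
                  (∀ y → σ (τ y) ≡ y) → (∀ x → τ (σ x) ≡ x) → sum (f ∘ σ) ≡ sum f
sum-∘-bijection f σ τ στ τσ = sym (∑-permute f (permutation σ τ στ τσ))

sum-𝕀≡0 : ∀ {n} (t : Fin n → Bool) → sum (𝕀 ∘ t) ≡ 0 → ∀ i → t i ≡ false
sum-𝕀≡0 {suc n} t e i with t zero in t₀
sum-𝕀≡0 {suc n} t e zero    | false = t₀
sum-𝕀≡0 {suc n} t e (suc i) | false = sum-𝕀≡0 (t ∘ suc) e i

sum-𝕀≡1 : ∀ {n} (t : Fin n → Bool) → sum (𝕀 ∘ t) ≡ 1 →
          ∃ λ x → t x ≡ true × (∀ y → t y ≡ true → y ≡ x)
sum-𝕀≡1 {suc n} t e with t zero in t₀
... | true = zero , t₀ , only-zero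
  where
  only-zero : ∀ y → t y ≡ true → y ≡ zero
  only-zero zero    _  = refl
  only-zero (suc y) ty = ⊥-elim (true≢false (trans (sym ty) (sum-𝕀≡0 (t ∘ suc) (suc-injective e) y)))
... | false with sum-𝕀≡1 (t ∘ suc) e
...   | x , tx , unique = suc x , tx , only-suc-x
  where
  only-suc-x : ∀ y → t y ≡ true → y ≡ suc x
  only-suc-x zero    ty = ⊥-elim (true≢false (trans (sym ty) t₀))
  only-suc-x (suc y) ty = cong suc (unique y ty)

sum-𝕀≡2 : ∀ {n} (t : Fin n → Bool) → sum (𝕀 ∘ t) ≡ 2 →
          ∃₂ λ x y → x ≢ y × t x ≡ true × t y ≡ true × (∀ z → t z ≡ true → z ≡ x ⊎ z ≡ y)
sum-𝕀≡2 {suc n} t e with t zero in t₀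
... | true with sum-𝕀≡1 (t ∘ suc) (suc-injective e)
...   | y , ty , unique = zero , suc y , (λ ()) , t₀ , ty , zero-or-suc-y
  where
  zero-or-suc-y : ∀ z → t z ≡ true → z ≡ zero ⊎ z ≡ suc y
  zero-or-suc-y zero    _  = inj₁ refl
  zero-or-suc-y (suc z) tz = inj₂ (cong suc (unique z tz))
sum-𝕀≡2 {suc n} t e | false with sum-𝕀≡2 (t ∘ suc) e
...   | x , y , x≢y , tx , ty , x-or-y = suc x , suc y , x≢y ∘ Finₚ.suc-injective , tx , ty , shifted
  where
  shifted : ∀ z → t z ≡ true → z ≡ suc x ⊎ z ≡ suc y
  shifted zero    tz = ⊥-elim (true≢false (trans (sym tz) t₀))
  shifted (suc z) tz with x-or-y z tz
  ... | inj₁ z≡x = inj₁ (cong suc z≡x)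
  ... | inj₂ z≡y = inj₂ (cong suc z≡y)

∣∣≡sum-lookup : ∀ {n} (v : Subset n) → ∣ v ∣ ≡ sum (𝕀 ∘ lookup v)
∣∣≡sum-lookup []          = refl
∣∣≡sum-lookup (true ∷ v)  = cong suc (∣∣≡sum-lookup v)
∣∣≡sum-lookup (false ∷ v) = ∣∣≡sum-lookup v

∣∷ʳ∣ : ∀ {n} (w : Subset n) b → ∣ w ∷ʳ b ∣ ≡ ∣ w ∣ + 𝕀 b
∣∷ʳ∣ []          true  = refl
∣∷ʳ∣ []          false = refl
∣∷ʳ∣ (true ∷ w)  b     = cong suc (∣∷ʳ∣ w b)
∣∷ʳ∣ (false ∷ w) b     = ∣∷ʳ∣ w b

lookup-∷ʳ-inject₁ : ∀ {n} (w : Subset n) b j → lookup (w ∷ʳ b) (inject₁ j) ≡ lookup w j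
lookup-∷ʳ-inject₁ (_ ∷ w) b zero    = refl
lookup-∷ʳ-inject₁ (_ ∷ w) b (suc j) = lookup-∷ʳ-inject₁ w b j

lookup-∷ʳ-fromℕ : ∀ {n} (w : Subset n) b → lookup (w ∷ʳ b) (fromℕ n) ≡ b
lookup-∷ʳ-fromℕ []      b = refl
lookup-∷ʳ-fromℕ (_ ∷ w) b = lookup-∷ʳ-fromℕ w b

⊆⇒lookup : ∀ {n} {T S : Subset n} → T ⊆ S → ∀ i → lookup T i ≡ true → lookup S i ≡ true
⊆⇒lookup {T = T} {S} T⊆S i e = Vecₚ.[]=⇒lookup (T⊆S (Vecₚ.lookup⇒[]= i T e))

lookup⇒⊆ : ∀ {n} {T S : Subset n} → (∀ i → lookup T i ≡ true → lookup S i ≡ true) → T ⊆ S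
lookup⇒⊆ {S = S} f {x} x∈T = Vecₚ.lookup⇒[]= x S (f x (Vecₚ.[]=⇒lookup x∈T))

∷ʳ-⊆⁻ : ∀ {n} (w w′ : Subset n) b b′ → w ∷ʳ b ⊆ w′ ∷ʳ b′ → w ⊆ w′ × (b ≡ true → b′ ≡ true)
∷ʳ-⊆⁻ {n} w w′ b b′ ⊆′ =
  lookup⇒⊆ (λ i e → trans (sym (lookup-∷ʳ-inject₁ w′ b′ i))
                          (⊆⇒lookup ⊆′ (inject₁ i) (trans (lookup-∷ʳ-inject₁ w b i) e))) ,
  λ e → trans (sym (lookup-∷ʳ-fromℕ w′ b′)) (⊆⇒lookup ⊆′ (fromℕ n) (trans (lookup-∷ʳ-fromℕ w b) e))

∷ʳ-⊆⁺ : ∀ {n} (w w′ : Subset n) b b′ → w ⊆ w′ → (b ≡ true → b′ ≡ true) → w ∷ʳ b ⊆ w′ ∷ʳ b′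
∷ʳ-⊆⁺ {n} w w′ b b′ w⊆w′ b⇒b′ = lookup⇒⊆ pointwise
  where
  pointwise : ∀ i → lookup (w ∷ʳ b) i ≡ true → lookup (w′ ∷ʳ b′) i ≡ true
  pointwise i with view i
  ... | ‵fromℕ = λ e → trans (lookup-∷ʳ-fromℕ w′ b′) (b⇒b′ (trans (sym (lookup-∷ʳ-fromℕ w b)) e))
  ... | ‵inj₁ {i = j} _ = λ e → trans (lookup-∷ʳ-inject₁ w′ b′ j)
                                  (⊆⇒lookup w⊆w′ j (trans (sym (lookup-∷ʳ-inject₁ w b j)) e))

pair : ∀ {n} → Fin n → Fin n → Subset n
pair x y = tabulate (λ i → does (i ≟ x) ∨ does (i ≟ y))

∈pair⁻ : ∀ {n} {x y : Fin n} i → lookup (pair x y) i ≡ true → i ≡ x ⊎ i ≡ y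
∈pair⁻ {x = x} {y} i i∈ with i ≟ x | i ≟ y | trans (sym (Vecₚ.lookup∘tabulate _ i)) i∈
... | yes i≡x | _       | _ = inj₁ i≡x
... | no _    | yes i≡y | _ = inj₂ i≡y

x∈pair : ∀ {n} (x y : Fin n) → lookup (pair x y) x ≡ true
x∈pair x y = trans (Vecₚ.lookup∘tabulate _ x) (cong (_∨ does (x ≟ y)) (dec-true (x ≟ x) refl))

y∈pair : ∀ {n} (x y : Fin n) → lookup (pair x y) y ≡ true
y∈pair x y = trans (Vecₚ.lookup∘tabulate _ y) (trans (cong (does (y ≟ x) ∨_) (dec-true (y ≟ y) refl)) (∨-zeroʳ _))

∣pair∣≡2 : ∀ {n} {x y : Fin n} → x ≢ y → ∣ pair x y ∣ ≡ 2
∣pair∣≡2 {x = x} {y} x≢y = begin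
  ∣ pair x y ∣                          ≡⟨ ∣∣≡sum-lookup (pair x y) ⟩
  sum (𝕀 ∘ lookup (pair x y))             ≡⟨ sum-cong-≗ (λ i → trans (cong 𝕀 (Vecₚ.lookup∘tabulate _ i))
                                              (𝕀-∨-disjoint (i ≟ x) (i ≟ y) (λ (i≡x , i≡y) → x≢y (trans (sym i≡x) i≡y)))) ⟩
  sum (λ i → δ i x + δ i y)              ≡⟨ ∑-distrib-+ (λ i → δ i x) (λ i → δ i y) ⟩
  sum (λ i → δ i x) + sum (λ i → δ i y)  ≡⟨ cong₂ _+_ (sum-δ₁ x) (sum-δ₁ y) ⟩
  2                                      ∎
  where open ≡-Reasoning

not-∨-true⁺ : ∀ t v → (t ≡ true → v ≡ true) → not t ∨ v ≡ true
not-∨-true⁺ true  v t⇒v = t⇒v refl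
not-∨-true⁺ false v _   = refl

not-∨-true⁻ : ∀ t v → not t ∨ v ≡ true → t ≡ true → v ≡ true
not-∨-true⁻ true v e _ = e

∷ʳ-⊆?-∷ʳ : ∀ {n} (w c : Subset n) t v → does (w ∷ʳ t ⊆? c ∷ʳ v) ≡ does (w ⊆? c) ∧ (not t ∨ v)
∷ʳ-⊆?-∷ʳ w c t v = bool-ext
  (λ e → let w⊆c , t⇒v = ∷ʳ-⊆⁻ w c t v (does-true⁻ (w ∷ʳ t ⊆? c ∷ʳ v) e)
         in cong₂ _∧_ (dec-true (w ⊆? c) w⊆c) (not-∨-true⁺ t v t⇒v))
  (λ e → let w⊆c , t⇒v = ∧-true⁻ (does (w ⊆? c)) (not t ∨ v) e
         in dec-true (w ∷ʳ t ⊆? c ∷ʳ v) (∷ʳ-⊆⁺ w c t v (does-true⁻ (w ⊆? c) w⊆c) (not-∨-true⁻ t v t⇒v)))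

⊆?-singleton : ∀ {n} (w c : Subset n) {x} →
               (∀ i → lookup w i ≡ true → i ≡ x) → lookup w x ≡ true → does (w ⊆? c) ≡ lookup c x
⊆?-singleton w c {x} only-x x∈w = bool-ext
  (λ e → ⊆⇒lookup (does-true⁻ (w ⊆? c) e) x x∈w)
  (λ x∈c → dec-true (w ⊆? c) (lookup⇒⊆ (λ i i∈w → subst (λ z → lookup c z ≡ true) (sym (only-x i i∈w)) x∈c)))

⊆?-pair : ∀ {n} (w c : Subset n) {x y} →
          (∀ i → lookup w i ≡ true → i ≡ x ⊎ i ≡ y) → lookup w x ≡ true → lookup w y ≡ true →
          does (w ⊆? c) ≡ lookup c x ∧ lookup c y
⊆?-pair w c {x} {y} x-or-y x∈w y∈w = bool-ext
  (λ e → cong₂ _∧_ (⊆⇒lookup (does-true⁻ (w ⊆? c) e) x x∈w) (⊆⇒lookup (does-true⁻ (w ⊆? c) e) y y∈w))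
  (λ e → dec-true (w ⊆? c) (lookup⇒⊆ (λ i i∈w → in-c i (x-or-y i i∈w) (∧-true⁻ _ _ e))))
  where
  in-c : ∀ i → i ≡ x ⊎ i ≡ y → lookup c x ≡ true × lookup c y ≡ true → lookup c i ≡ true
  in-c i (inj₁ refl) (x∈c , _) = x∈c
  in-c i (inj₂ refl) (_ , y∈c) = y∈c

blockCount-++ : ∀ {n} (B C : List (Subset n)) T → blockCount (B ++ C) T ≡ blockCount B T + blockCount C T
blockCount-++ B C T = trans (cong length (Listₚ.filter-++ (T ⊆?_) B C)) (Listₚ.length-++ (filter (T ⊆?_) B))

blockCount-[_] : ∀ {n} (b : Subset n) T → blockCount (b ∷ []) T ≡ 𝕀 (does (T ⊆? b))
blockCount-[ b ] T with T ⊆? b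
... | yes _ = refl
... | no _  = refl

1+2h≡1mod4⇒h≡2[p/4] : ∀ p h → p ≡ 1 + 2 * h → p % 4 ≡ 1 → h ≡ 2 * (p / 4)
1+2h≡1mod4⇒h≡2[p/4] p h p≡1+2h p%4≡1 = *-cancelˡ-≡ h (2 * (p / 4)) 2 (suc-injective (begin
  1 + 2 * h              ≡⟨ sym p≡1+2h ⟩
  p                      ≡⟨ m≡m%n+[m/n]*n p 4 ⟩
  p % 4 + p / 4 * 4      ≡⟨ cong₂ _+_ p%4≡1 (quadruple (p / 4)) ⟩
  1 + 2 * (2 * (p / 4))  ∎))
  where
  open ≡-Reasoning
  quadruple : ∀ x → x * 4 ≡ 2 * (2 * x)
  quadruple = solve-∀

1mod4∧5<p⇒2≤p/4 : ∀ p → p % 4 ≡ 1 → 5 < p → 2 ≤ p / 4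
1mod4∧5<p⇒2≤p/4 p p%4≡1 5<p with p / 4 | m≡m%n+[m/n]*n p 4
... | zero        | p≡ = ⊥-elim (<⇒≱ 5<p (≤-trans (≤-reflexive (trans p≡ (cong (_+ 0) p%4≡1))) (s≤s z≤n)))
... | suc zero    | p≡ = ⊥-elim (<⇒≱ 5<p (≤-reflexive (trans p≡ (cong (_+ 4) p%4≡1))))
... | suc (suc _) | _  = s≤s (s≤s z≤n)

quarters : ∀ p r → p ≡ 1 + (2 + r) * 4 →
           (p ∸ 1) / 4 ≡ 2 + r × (p ∸ 5) / 4 ≡ 1 + r × (p ∸ 9) / 4 ≡ r
quarters p r refl = m*n/n≡m (2 + r) 4 , m*n/n≡m (1 + r) 4 , m*n/n≡m r 4

[1+2h+1]/2≡1+h : ∀ p h → p ≡ 1 + 2 * h → (p + 1) / 2 ≡ 1 + h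
[1+2h+1]/2≡1+h p h refl = trans (cong (_/ 2) (double h)) (m*n/n≡m (1 + h) 2)
  where
  double : ∀ h → 1 + 2 * h + 1 ≡ (1 + h) * 2
  double = solve-∀

module ZMod (p : ℕ) .{{_ : NonZero p}} (1<p : 1 < p) where

  ⟦_⟧ : ℕ → Fin p
  ⟦ n ⟧ = fromℕ< (m%n<n n p)

  toℕ-⟦⟧ : ∀ n → toℕ ⟦ n ⟧ ≡ n % p
  toℕ-⟦⟧ n = Finₚ.toℕ-fromℕ< _

  ⟦⟧-cong : ∀ {a b} → a % p ≡ b % p → ⟦ a ⟧ ≡ ⟦ b ⟧
  ⟦⟧-cong e = Finₚ.toℕ-injective (trans (toℕ-⟦⟧ _) (trans e (sym (toℕ-⟦⟧ _))))

  ⟦toℕ⟧ : ∀ x → ⟦ toℕ x ⟧ ≡ x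
  ⟦toℕ⟧ x = Finₚ.toℕ-injective (trans (toℕ-⟦⟧ _) (m<n⇒m%n≡m (Finₚ.toℕ<n x)))

  infixl 6 _⊕_
  infixl 7 _⊗_
  infix  8 ⊖_

  _⊕_ _⊗_ : Fin p → Fin p → Fin p
  x ⊕ y = ⟦ toℕ x + toℕ y ⟧
  x ⊗ y = ⟦ toℕ x * toℕ y ⟧

  ⊖_ : Fin p → Fin p
  ⊖ x = ⟦ p ∸ toℕ x ⟧

  𝟘 𝟙 : Fin p
  𝟘 = ⟦ 0 ⟧
  𝟙 = ⟦ 1 ⟧

  toℕ-𝟘 : toℕ 𝟘 ≡ 0
  toℕ-𝟘 = trans (toℕ-⟦⟧ 0) (m<n⇒m%n≡m (>-nonZero⁻¹ p))

  toℕ-𝟙 : toℕ 𝟙 ≡ 1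
  toℕ-𝟙 = trans (toℕ-⟦⟧ 1) (m<n⇒m%n≡m 1<p)

  ⟦+⟧ : ∀ m n → ⟦ m + n ⟧ ≡ ⟦ m ⟧ ⊕ ⟦ n ⟧
  ⟦+⟧ m n = ⟦⟧-cong (trans (%-distribˡ-+ m n p) (sym (cong₂ (λ a b → (a + b) % p) (toℕ-⟦⟧ m) (toℕ-⟦⟧ n))))

  ⟦*⟧ : ∀ m n → ⟦ m * n ⟧ ≡ ⟦ m ⟧ ⊗ ⟦ n ⟧
  ⟦*⟧ m n = ⟦⟧-cong (trans (%-distribˡ-* m n p) (sym (cong₂ (λ a b → (a * b) % p) (toℕ-⟦⟧ m) (toℕ-⟦⟧ n))))

  ⟦⟧-⊕ : ∀ m z → ⟦ m ⟧ ⊕ z ≡ ⟦ m + toℕ z ⟧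
  ⟦⟧-⊕ m z = trans (cong (⟦ m ⟧ ⊕_) (sym (⟦toℕ⟧ z))) (sym (⟦+⟧ m (toℕ z)))

  ⊕-⟦⟧ : ∀ x m → x ⊕ ⟦ m ⟧ ≡ ⟦ toℕ x + m ⟧
  ⊕-⟦⟧ x m = trans (cong (_⊕ ⟦ m ⟧) (sym (⟦toℕ⟧ x))) (sym (⟦+⟧ (toℕ x) m))

  ⟦⟧-⊗ : ∀ m z → ⟦ m ⟧ ⊗ z ≡ ⟦ m * toℕ z ⟧
  ⟦⟧-⊗ m z = trans (cong (⟦ m ⟧ ⊗_) (sym (⟦toℕ⟧ z))) (sym (⟦*⟧ m (toℕ z)))

  ⊗-⟦⟧ : ∀ x m → x ⊗ ⟦ m ⟧ ≡ ⟦ toℕ x * m ⟧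
  ⊗-⟦⟧ x m = trans (cong (_⊗ ⟦ m ⟧) (sym (⟦toℕ⟧ x))) (sym (⟦*⟧ (toℕ x) m))

  ⊕-assoc : ∀ x y z → (x ⊕ y) ⊕ z ≡ x ⊕ (y ⊕ z)
  ⊕-assoc x y z = trans (⟦⟧-⊕ (toℕ x + toℕ y) z)
    (trans (cong ⟦_⟧ (+-assoc (toℕ x) (toℕ y) (toℕ z))) (sym (⊕-⟦⟧ x (toℕ y + toℕ z))))

  ⊗-assoc : ∀ x y z → (x ⊗ y) ⊗ z ≡ x ⊗ (y ⊗ z)
  ⊗-assoc x y z = trans (⟦⟧-⊗ (toℕ x * toℕ y) z)
    (trans (cong ⟦_⟧ (*-assoc (toℕ x) (toℕ y) (toℕ z))) (sym (⊗-⟦⟧ x (toℕ y * toℕ z))))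

  ⊕-comm : ∀ x y → x ⊕ y ≡ y ⊕ x
  ⊕-comm x y = cong ⟦_⟧ (+-comm (toℕ x) (toℕ y))

  ⊗-comm : ∀ x y → x ⊗ y ≡ y ⊗ x
  ⊗-comm x y = cong ⟦_⟧ (*-comm (toℕ x) (toℕ y))

  ⊕-identityˡ : ∀ x → 𝟘 ⊕ x ≡ x
  ⊕-identityˡ x = trans (⟦⟧-⊕ 0 x) (⟦toℕ⟧ x)

  ⊕-identityʳ : ∀ x → x ⊕ 𝟘 ≡ x
  ⊕-identityʳ x = trans (⊕-comm x 𝟘) (⊕-identityˡ x)

  ⊗-identityˡ : ∀ x → 𝟙 ⊗ x ≡ x
  ⊗-identityˡ x = trans (⟦⟧-⊗ 1 x) (trans (cong ⟦_⟧ (*-identityˡ (toℕ x))) (⟦toℕ⟧ x))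

  ⊗-identityʳ : ∀ x → x ⊗ 𝟙 ≡ x
  ⊗-identityʳ x = trans (⊗-comm x 𝟙) (⊗-identityˡ x)

  ⊖-inverseˡ : ∀ x → ⊖ x ⊕ x ≡ 𝟘
  ⊖-inverseˡ x = begin
    ⟦ p ∸ toℕ x ⟧ ⊕ x      ≡⟨ ⟦⟧-⊕ (p ∸ toℕ x) x ⟩
    ⟦ p ∸ toℕ x + toℕ x ⟧  ≡⟨ cong ⟦_⟧ (m∸n+n≡m (<⇒≤ (Finₚ.toℕ<n x))) ⟩
    ⟦ p ⟧                  ≡⟨ ⟦⟧-cong (trans (n%n≡0 p) (sym (m<n⇒m%n≡m (>-nonZero⁻¹ p)))) ⟩
    𝟘                      ∎
    where open ≡-Reasoning

  ⊖-inverseʳ : ∀ x → x ⊕ ⊖ x ≡ 𝟘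
  ⊖-inverseʳ x = trans (⊕-comm x (⊖ x)) (⊖-inverseˡ x)

  ⊗-distribˡ-⊕ : ∀ x y z → x ⊗ (y ⊕ z) ≡ x ⊗ y ⊕ x ⊗ z
  ⊗-distribˡ-⊕ x y z = trans (⊗-⟦⟧ x (toℕ y + toℕ z))
    (trans (cong ⟦_⟧ (*-distribˡ-+ (toℕ x) (toℕ y) (toℕ z))) (⟦+⟧ (toℕ x * toℕ y) (toℕ x * toℕ z)))

  ⊗-distribʳ-⊕ : ∀ x y z → (y ⊕ z) ⊗ x ≡ y ⊗ x ⊕ z ⊗ x
  ⊗-distribʳ-⊕ x y z = trans (⊗-comm (y ⊕ z) x)
    (trans (⊗-distribˡ-⊕ x y z) (cong₂ _⊕_ (⊗-comm x y) (⊗-comm x z)))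

  isCommutativeRing : IsCommutativeRing _≡_ _⊕_ _⊗_ ⊖_ 𝟘 𝟙
  isCommutativeRing = record
    { isRing = record
      { +-isAbelianGroup = record
        { isGroup = record
          { isMonoid = record
            { isSemigroup = record
              { isMagma = record { isEquivalence = isEquivalence ; ∙-cong = cong₂ _⊕_ }
              ; assoc = ⊕-assoc }
            ; identity = ⊕-identityˡ , ⊕-identityʳ }
          ; inverse = ⊖-inverseˡ , ⊖-inverseʳ
          ; ⁻¹-cong = cong ⊖_ }
        ; comm = ⊕-comm }
      ; *-cong = cong₂ _⊗_
      ; *-assoc = ⊗-assoc
      ; *-identity = ⊗-identityˡ , ⊗-identityʳ
      ; distrib = ⊗-distribˡ-⊕ , ⊗-distribʳ-⊕ }
    ; *-comm = ⊗-comm }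

  commutativeRing : CommutativeRing _ _
  commutativeRing = record { isCommutativeRing = isCommutativeRing }

  open import Algebra.Properties.Ring (CommutativeRing.ring commutativeRing) public
    using (-‿distribˡ-*; -‿distribʳ-*; -‿involutive; -‿anti-homo-+; -0#≈0#; +-inverseˡ-unique; +-inverseʳ-unique; x∙y⁻¹≈ε⇒x≈y)

  ⊕-⊖𝟘 : ∀ x → x ⊕ ⊖ 𝟘 ≡ x
  ⊕-⊖𝟘 x = trans (cong (x ⊕_) -0#≈0#) (⊕-identityʳ x)

  ⊗-zeroʳ : ∀ x → x ⊗ 𝟘 ≡ 𝟘
  ⊗-zeroʳ x = trans (⊗-⟦⟧ x 0) (cong ⟦_⟧ (*-zeroʳ (toℕ x)))

  fromℤ : ℤ → Fin p
  fromℤ (ℤ.+ n)    = ⟦ n ⟧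
  fromℤ ℤ.-[1+ n ] = ⊖ ⟦ suc n ⟧

  fromℤ-⊖ : ∀ m n → fromℤ (m ℤ.⊖ n) ≡ ⟦ m ⟧ ⊕ ⊖ ⟦ n ⟧
  fromℤ-⊖ m       zero    = sym (⊕-⊖𝟘 ⟦ m ⟧)
  fromℤ-⊖ zero    (suc n) = sym (⊕-identityˡ _)
  fromℤ-⊖ (suc m) (suc n) = begin
    fromℤ (suc m ℤ.⊖ suc n)          ≡⟨ cong fromℤ (ℤₚ.[1+m]⊖[1+n]≡m⊖n m n) ⟩
    fromℤ (m ℤ.⊖ n)                  ≡⟨ fromℤ-⊖ m n ⟩
    ⟦ m ⟧ ⊕ ⊖ ⟦ n ⟧                  ≡⟨ sym (⊕-identityʳ _) ⟩
    ⟦ m ⟧ ⊕ ⊖ ⟦ n ⟧ ⊕ 𝟘              ≡⟨ cong (⟦ m ⟧ ⊕ ⊖ ⟦ n ⟧ ⊕_) (sym (⊖-inverseʳ 𝟙)) ⟩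
    ⟦ m ⟧ ⊕ ⊖ ⟦ n ⟧ ⊕ (𝟙 ⊕ ⊖ 𝟙)      ≡⟨ M.solve 4 (λ a b c d → (a M.⊕ b) M.⊕ (c M.⊕ d) M.⊜ (c M.⊕ a) M.⊕ (b M.⊕ d))
                                           refl ⟦ m ⟧ (⊖ ⟦ n ⟧) 𝟙 (⊖ 𝟙) ⟩
    (𝟙 ⊕ ⟦ m ⟧) ⊕ (⊖ ⟦ n ⟧ ⊕ ⊖ 𝟙)    ≡⟨ cong₂ _⊕_ (sym (⟦+⟧ 1 m)) (sym (-‿anti-homo-+ 𝟙 ⟦ n ⟧)) ⟩
    ⟦ suc m ⟧ ⊕ ⊖ (𝟙 ⊕ ⟦ n ⟧)        ≡⟨ cong (λ z → ⟦ suc m ⟧ ⊕ ⊖ z) (sym (⟦+⟧ 1 n)) ⟩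
    ⟦ suc m ⟧ ⊕ ⊖ ⟦ suc n ⟧          ∎
    where
    open ≡-Reasoning
    module M = CommutativeMonoidSolver (CommutativeRing.+-commutativeMonoid commutativeRing)

  fromℤ-+ : ∀ i j → fromℤ (i ℤ.+ j) ≡ fromℤ i ⊕ fromℤ j
  fromℤ-+ (ℤ.+ m)    (ℤ.+ n)    = ⟦+⟧ m n
  fromℤ-+ (ℤ.+ m)    ℤ.-[1+ n ] = fromℤ-⊖ m (suc n)
  fromℤ-+ ℤ.-[1+ m ] (ℤ.+ n)    = trans (fromℤ-⊖ n (suc m)) (⊕-comm ⟦ n ⟧ (⊖ ⟦ suc m ⟧))
  fromℤ-+ ℤ.-[1+ m ] ℤ.-[1+ n ] = begin
    ⊖ ⟦ suc (suc (m + n)) ⟧        ≡⟨ cong (λ k → ⊖ ⟦ k ⟧) (sym (+-suc (suc m) n)) ⟩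
    ⊖ ⟦ suc m + suc n ⟧            ≡⟨ cong ⊖_ (⟦+⟧ (suc m) (suc n)) ⟩
    ⊖ (⟦ suc m ⟧ ⊕ ⟦ suc n ⟧)      ≡⟨ -‿anti-homo-+ ⟦ suc m ⟧ ⟦ suc n ⟧ ⟩
    ⊖ ⟦ suc n ⟧ ⊕ ⊖ ⟦ suc m ⟧      ≡⟨ ⊕-comm (⊖ ⟦ suc n ⟧) (⊖ ⟦ suc m ⟧) ⟩
    ⊖ ⟦ suc m ⟧ ⊕ ⊖ ⟦ suc n ⟧      ∎
    where open ≡-Reasoning

  signed : Sign → Fin p → Fin p
  signed Sign.+ x = x
  signed Sign.- x = ⊖ x

  fromℤ-◃ : ∀ s n → fromℤ (s ℤ.◃ n) ≡ signed s ⟦ n ⟧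
  fromℤ-◃ Sign.+ zero    = refl
  fromℤ-◃ Sign.- zero    = sym -0#≈0#
  fromℤ-◃ Sign.+ (suc n) = refl
  fromℤ-◃ Sign.- (suc n) = refl

  fromℤ-sign-abs : ∀ i → fromℤ i ≡ signed (ℤ.sign i) ⟦ ℤ.∣ i ∣ ⟧
  fromℤ-sign-abs (ℤ.+ n)    = refl
  fromℤ-sign-abs ℤ.-[1+ n ] = refl

  signed-⊗ : ∀ s t x y → signed (s Sign.* t) (x ⊗ y) ≡ signed s x ⊗ signed t y
  signed-⊗ Sign.+ Sign.+ x y = refl
  signed-⊗ Sign.+ Sign.- x y = -‿distribʳ-* x y
  signed-⊗ Sign.- Sign.+ x y = -‿distribˡ-* x y
  signed-⊗ Sign.- Sign.- x y =
    trans (sym (-‿involutive (x ⊗ y))) (trans (cong ⊖_ (-‿distribʳ-* x y)) (-‿distribˡ-* x (⊖ y)))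

  fromℤ-* : ∀ i j → fromℤ (i ℤ.* j) ≡ fromℤ i ⊗ fromℤ j
  fromℤ-* i j = begin
    fromℤ (s ℤ.◃ ℤ.∣ i ∣ * ℤ.∣ j ∣)                         ≡⟨ fromℤ-◃ s (ℤ.∣ i ∣ * ℤ.∣ j ∣) ⟩
    signed s ⟦ ℤ.∣ i ∣ * ℤ.∣ j ∣ ⟧                          ≡⟨ cong (signed s) (⟦*⟧ ℤ.∣ i ∣ ℤ.∣ j ∣) ⟩
    signed s (⟦ ℤ.∣ i ∣ ⟧ ⊗ ⟦ ℤ.∣ j ∣ ⟧)                    ≡⟨ signed-⊗ (ℤ.sign i) (ℤ.sign j) _ _ ⟩
    signed (ℤ.sign i) ⟦ ℤ.∣ i ∣ ⟧ ⊗ signed (ℤ.sign j) ⟦ ℤ.∣ j ∣ ⟧ ≡⟨ sym (cong₂ _⊗_ (fromℤ-sign-abs i) (fromℤ-sign-abs j)) ⟩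
    fromℤ i ⊗ fromℤ j                                       ∎
    where
    open ≡-Reasoning
    s = ℤ.sign i Sign.* ℤ.sign j

  fromℤ-neg : ∀ i → fromℤ (ℤ.- i) ≡ ⊖ fromℤ i
  fromℤ-neg (ℤ.+ zero)    = sym -0#≈0#
  fromℤ-neg (ℤ.+ suc n)   = refl
  fromℤ-neg ℤ.-[1+ n ]    = sym (-‿involutive _)

  -- The ring solver needs coefficients whose arithmetic computes, and that of Fin p does not
  -- for a variable p; so the coefficients are integers, interpreted through fromℤ.
  fromℤ-morphism : ℤ.+-*-rawRing -Raw-AlmostCommutative⟶ fromCommutativeRing commutativeRing
  fromℤ-morphism = record
    { ⟦_⟧ = fromℤ ; +-homo = fromℤ-+ ; *-homo = fromℤ-* ; -‿homo = fromℤ-neg ; 0-homo = refl ; 1-homo = refl }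

  fromℤ-≟ : ∀ i j → Maybe (fromℤ i ≡ fromℤ j)
  fromℤ-≟ i j = Maybe.map (cong fromℤ) (dec⇒maybe (i ℤ.≟ j))

  open Solver ℤ.+-*-rawRing (fromCommutativeRing commutativeRing) fromℤ-morphism fromℤ-≟ public
    using (solve; _:+_; _:*_; :-_; _:=_; con)

  sum-∘-⊕ : ∀ a (f : Fin p → ℕ) → sum (λ x → f (x ⊕ a)) ≡ sum f
  sum-∘-⊕ a f = sum-∘-bijection f (_⊕ a) (_⊕ ⊖ a)
    (λ y → solve 2 (λ y a → y :+ :- a :+ a := y) refl y a)
    (λ x → solve 2 (λ x a → x :+ a :+ :- a := x) refl x a)

  sum-∘-reflect : ∀ a (f : Fin p → ℕ) → sum (λ x → f (a ⊕ ⊖ x)) ≡ sum f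
  sum-∘-reflect a f = sum-∘-bijection f (λ x → a ⊕ ⊖ x) (λ x → a ⊕ ⊖ x) involution involution
    where
    involution : ∀ y → a ⊕ ⊖ (a ⊕ ⊖ y) ≡ y
    involution y = solve 2 (λ y a → a :+ :- (a :+ :- y) := y) refl y a

  sum-∘-⊗ : ∀ d u → d ⊗ u ≡ 𝟙 → (f : Fin p → ℕ) → sum (λ x → f (d ⊗ x)) ≡ sum f
  sum-∘-⊗ d u du≡𝟙 f = sum-∘-bijection f (d ⊗_) (u ⊗_)
    (λ y → trans (sym (⊗-assoc d u y)) (trans (cong (_⊗ y) du≡𝟙) (⊗-identityˡ y)))
    (λ x → trans (sym (⊗-assoc u d x)) (trans (cong (_⊗ x) (trans (⊗-comm u d) du≡𝟙)) (⊗-identityˡ x)))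

module PrimeField (p : ℕ) .{{_ : NonZero p}} (p-prime : Prime p) where

  open ZMod p (nonTrivial⇒n>1 p {{prime⇒nonTrivial p-prime}}) public

  toℕ≡0⇒≡𝟘 : ∀ {x} → toℕ x ≡ 0 → x ≡ 𝟘
  toℕ≡0⇒≡𝟘 e = Finₚ.toℕ-injective (trans e (sym toℕ-𝟘))

  𝟙≢𝟘 : 𝟙 ≢ 𝟘
  𝟙≢𝟘 e = 1+n≢0 (trans (sym toℕ-𝟙) (trans (cong toℕ e) toℕ-𝟘))

  p∣⇒≡𝟘 : ∀ x → p ∣ toℕ x → x ≡ 𝟘
  p∣⇒≡𝟘 x p∣x = toℕ≡0⇒≡𝟘 (trans (sym (m<n⇒m%n≡m (Finₚ.toℕ<n x))) (n∣m⇒m%n≡0 _ p p∣x))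

  zero-divisor : ∀ {x y} → x ⊗ y ≡ 𝟘 → x ≡ 𝟘 ⊎ y ≡ 𝟘
  zero-divisor {x} {y} xy≡𝟘 =
    Sum.map (p∣⇒≡𝟘 x) (p∣⇒≡𝟘 y) (euclidsLemma (toℕ x) (toℕ y) p-prime
      (m%n≡0⇒n∣m _ p (trans (sym (toℕ-⟦⟧ _)) (trans (cong toℕ xy≡𝟘) toℕ-𝟘))))

  ⊗-≢𝟘 : ∀ {x y} → x ≢ 𝟘 → y ≢ 𝟘 → x ⊗ y ≢ 𝟘
  ⊗-≢𝟘 x≢𝟘 y≢𝟘 xy≡𝟘 = Sum.[ x≢𝟘 , y≢𝟘 ] (zero-divisor xy≡𝟘)

  ⊗-inverse : ∀ x → x ≢ 𝟘 → ∃ λ u → x ⊗ u ≡ 𝟙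
  ⊗-inverse x x≢𝟘 with coprime-Bézout (prime⇒coprime p-prime {{≢-nonZero toℕx≢0}} (Finₚ.toℕ<n x))
    where toℕx≢0 = λ e → x≢𝟘 (toℕ≡0⇒≡𝟘 e)
  ... | Bézout.-+ a b eq = ⟦ b ⟧ , (begin
    x ⊗ ⟦ b ⟧      ≡⟨ ⊗-⟦⟧ x b ⟩
    ⟦ toℕ x * b ⟧  ≡⟨ cong ⟦_⟧ (trans (*-comm (toℕ x) b) (sym eq)) ⟩
    ⟦ 1 + a * p ⟧  ≡⟨ ⟦⟧-cong ([m+kn]%n≡m%n 1 a p) ⟩
    𝟙              ∎)
    where open ≡-Reasoning
  ... | Bézout.+- a b eq = ⊖ ⟦ b ⟧ , (begin
    x ⊗ ⊖ ⟦ b ⟧    ≡⟨ sym (-‿distribʳ-* x ⟦ b ⟧) ⟩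
    ⊖ (x ⊗ ⟦ b ⟧)  ≡⟨ cong ⊖_ (+-inverseʳ-unique 𝟙 (x ⊗ ⟦ b ⟧) 𝟙+xb≡𝟘) ⟩
    ⊖ ⊖ 𝟙          ≡⟨ -‿involutive 𝟙 ⟩
    𝟙              ∎)
    where
    open ≡-Reasoning
    𝟙+xb≡𝟘 : 𝟙 ⊕ x ⊗ ⟦ b ⟧ ≡ 𝟘
    𝟙+xb≡𝟘 = begin
      𝟙 ⊕ x ⊗ ⟦ b ⟧          ≡⟨ cong (𝟙 ⊕_) (⊗-⟦⟧ x b) ⟩
      ⟦ 1 ⟧ ⊕ ⟦ toℕ x * b ⟧  ≡⟨ sym (⟦+⟧ 1 (toℕ x * b)) ⟩
      ⟦ 1 + toℕ x * b ⟧      ≡⟨ cong (λ m → ⟦ 1 + m ⟧) (*-comm (toℕ x) b) ⟩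
      ⟦ 1 + b * toℕ x ⟧      ≡⟨ cong ⟦_⟧ eq ⟩
      ⟦ a * p ⟧              ≡⟨ ⟦⟧-cong (trans (m*n%n≡0 a p) (sym (m<n⇒m%n≡m (>-nonZero⁻¹ p)))) ⟩
      𝟘                      ∎

  inverse-≢𝟘 : ∀ {d u} → d ⊗ u ≡ 𝟙 → u ≢ 𝟘
  inverse-≢𝟘 {d} du≡𝟙 refl = 𝟙≢𝟘 (trans (sym du≡𝟙) (⊗-zeroʳ d))

  squares-≡ : ∀ y z → y ⊗ y ≡ z ⊗ z → y ≡ z ⊎ y ≡ ⊖ z
  squares-≡ y z yy≡zz = Sum.map (x∙y⁻¹≈ε⇒x≈y y z) (λ y+z≡𝟘 → +-inverseʳ-unique z y (trans (⊕-comm z y) y+z≡𝟘))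
    (zero-divisor (begin
      (y ⊕ ⊖ z) ⊗ (y ⊕ z)   ≡⟨ solve 2 (λ y z → (y :+ :- z) :* (y :+ z) := y :* y :+ :- (z :* z)) refl y z ⟩
      y ⊗ y ⊕ ⊖ (z ⊗ z)     ≡⟨ cong (_⊕ ⊖ (z ⊗ z)) yy≡zz ⟩
      z ⊗ z ⊕ ⊖ (z ⊗ z)     ≡⟨ ⊖-inverseʳ (z ⊗ z) ⟩
      𝟘                     ∎))
    where open ≡-Reasoning

  ≢⊖-self : 2 < p → ∀ {y} → y ≢ 𝟘 → y ≢ ⊖ y
  ≢⊖-self 2<p {y} y≢𝟘 y≡-y = Sum.[ 𝟚≢𝟘 , y≢𝟘 ] (zero-divisor (begin
      (𝟙 ⊕ 𝟙) ⊗ y  ≡⟨ solve 1 (λ y → (con ℤ.1ℤ :+ con ℤ.1ℤ) :* y := y :+ y) refl y ⟩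
      y ⊕ y        ≡⟨ cong (y ⊕_) y≡-y ⟩
      y ⊕ ⊖ y      ≡⟨ ⊖-inverseʳ y ⟩
      𝟘            ∎))
    where
    open ≡-Reasoning
    𝟚≢𝟘 : 𝟙 ⊕ 𝟙 ≢ 𝟘
    𝟚≢𝟘 e = 1+n≢0 (begin
      2          ≡⟨ sym (m<n⇒m%n≡m 2<p) ⟩
      2 % p      ≡⟨ sym (toℕ-⟦⟧ 2) ⟩
      toℕ ⟦ 2 ⟧  ≡⟨ cong toℕ (trans (⟦+⟧ 1 1) e) ⟩
      toℕ 𝟘      ≡⟨ toℕ-𝟘 ⟩
      0          ∎)

module QuadraticResidues (p : ℕ) .{{_ : NonZero p}} (p-prime : Prime p) (2<p : 2 < p) where

  open PrimeField p p-prime public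

  Residue NonResidue : Fin p → Set
  Residue x    = x ≢ 𝟘 × ∃ λ y → y ⊗ y ≡ x
  NonResidue x = x ≢ 𝟘 × ¬ Residue x

  -- Opaque, so that type checking never unfolds isQR?, whose normal forms are very large.
  opaque
    residue? : ∀ x → Dec (Residue x)
    residue? x = map′ fromIsQR toIsQR (isQR? p x)
      where
      fromIsQR : IsQR p x → Residue x
      fromIsQR (toℕx≢0 , y , yy≡x) =
        (λ x≡𝟘 → toℕx≢0 (trans (cong toℕ x≡𝟘) toℕ-𝟘)) , y , Finₚ.toℕ-injective (trans (toℕ-⟦⟧ _) yy≡x)
      toIsQR : Residue x → IsQR p x
      toIsQR (x≢𝟘 , y , yy≡x) = (λ e → x≢𝟘 (toℕ≡0⇒≡𝟘 e)) , y , trans (sym (toℕ-⟦⟧ _)) (cong toℕ yy≡x)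

  nonResidue? : ∀ x → Dec (NonResidue x)
  nonResidue? x = ¬? (x ≟ 𝟘) ×-dec ¬? (residue? x)

  isZero isResidue isNonResidue : Fin p → Bool
  isZero       x = does (x ≟ 𝟘)
  isResidue    x = does (residue? x)
  isNonResidue x = does (nonResidue? x)

  [0] [D] [N] : Fin p → ℕ
  [0] = 𝕀 ∘ isZero
  [D] = 𝕀 ∘ isResidue
  [N] = 𝕀 ∘ isNonResidue

  #D #N : ℕ
  #D = sum [D]
  #N = sum [N]

  data Class (x : Fin p) : Set where
    zero       : x ≡ 𝟘 → Class x
    residue    : Residue x → Class x
    nonResidue : NonResidue x → Class x

  classify : ∀ x → Class x
  classify x with x ≟ 𝟘 | residue? x
  ... | yes x≡𝟘 | _         = zero x≡𝟘
  ... | no _    | yes r     = residue r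
  ... | no x≢𝟘  | no ¬r     = nonResidue (x≢𝟘 , ¬r)

  trichotomy : ∀ x → [0] x + [D] x + [N] x ≡ 1
  trichotomy x with isZero x in z | isResidue x in r
  ... | true  | true  = ⊥-elim (proj₁ (does-true⁻ (residue? x) r) (does-true⁻ (x ≟ 𝟘) z))
  ... | true  | false = refl
  ... | false | true  = refl
  ... | false | false = refl

  weighted-trichotomy : ∀ y m → [0] y * m + [D] y * m + [N] y * m ≡ m
  weighted-trichotomy y m = trans (sym (distrib ([0] y) ([D] y) ([N] y) m))
                                  (trans (cong (_* m) (trichotomy y)) (*-identityˡ m))
    where
    distrib : ∀ a b c m → (a + b + c) * m ≡ a * m + b * m + c * m
    distrib = solve-∀

  isZero-⊗ : ∀ {d} z → d ≢ 𝟘 → isZero (d ⊗ z) ≡ isZero z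
  isZero-⊗ {d} z d≢𝟘 = does-⇔ (mk⇔ (λ dz≡𝟘 → Sum.[ ⊥-elim ∘ d≢𝟘 , id ] (zero-divisor dz≡𝟘))
                                   (λ z≡𝟘 → trans (cong (d ⊗_) z≡𝟘) (⊗-zeroʳ d)))
                              (d ⊗ z ≟ 𝟘) (z ≟ 𝟘)

  Residue-⊗ : ∀ {d e} → Residue d → Residue e → Residue (d ⊗ e)
  Residue-⊗ (d≢𝟘 , y , yy≡d) (e≢𝟘 , z , zz≡e) = ⊗-≢𝟘 d≢𝟘 e≢𝟘 , y ⊗ z , (begin
    (y ⊗ z) ⊗ (y ⊗ z)  ≡⟨ solve 2 (λ y z → (y :* z) :* (y :* z) := (y :* y) :* (z :* z)) refl y z ⟩
    (y ⊗ y) ⊗ (z ⊗ z)  ≡⟨ cong₂ _⊗_ yy≡d zz≡e ⟩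
    _                  ∎)
    where open ≡-Reasoning

  Residue-square : ∀ {y} → y ≢ 𝟘 → Residue (y ⊗ y)
  Residue-square {y} y≢𝟘 = ⊗-≢𝟘 y≢𝟘 y≢𝟘 , y , refl

  Residue-𝟙 : Residue 𝟙
  Residue-𝟙 = 𝟙≢𝟘 , 𝟙 , ⊗-identityˡ 𝟙

  Residue-inverse : ∀ {d u} → Residue d → d ⊗ u ≡ 𝟙 → Residue u
  Residue-inverse {d} {u} rd du≡𝟙 = subst Residue d⊗u⊗u≡u (Residue-⊗ rd (Residue-square {u} (inverse-≢𝟘 {d} du≡𝟙)))
    where
    d⊗u⊗u≡u : d ⊗ (u ⊗ u) ≡ u
    d⊗u⊗u≡u = trans (sym (⊗-assoc d u u)) (trans (cong (_⊗ u) du≡𝟙) (⊗-identityˡ u))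

  ⊗-cancel-inverse : ∀ {d u} x → d ⊗ u ≡ 𝟙 → x ⊗ d ⊗ u ≡ x
  ⊗-cancel-inverse {d} {u} x du≡𝟙 = trans (⊗-assoc x d u) (trans (cong (x ⊗_) du≡𝟙) (⊗-identityʳ x))

  isResidue-⊗ : ∀ {d} z → Residue d → isResidue (d ⊗ z) ≡ isResidue z
  isResidue-⊗ {d} z rd with ⊗-inverse d (proj₁ rd)
  ... | u , du≡𝟙 = does-⇔ (mk⇔ (λ rdz → subst Residue u⊗d⊗z≡z (Residue-⊗ (Residue-inverse rd du≡𝟙) rdz))
                               (Residue-⊗ rd))
                          (residue? (d ⊗ z)) (residue? z)
    where
    u⊗d⊗z≡z : u ⊗ (d ⊗ z) ≡ z
    u⊗d⊗z≡z = trans (sym (⊗-assoc u d z)) (trans (cong (_⊗ z) (trans (⊗-comm u d) du≡𝟙)) (⊗-identityˡ z))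

  NonResidue-⊗-Residue : ∀ {n z} → NonResidue n → Residue z → NonResidue (n ⊗ z)
  NonResidue-⊗-Residue {n} {z} (n≢𝟘 , ¬rn) rz with ⊗-inverse z (proj₁ rz)
  ... | u , zu≡𝟙 = ⊗-≢𝟘 n≢𝟘 (proj₁ rz) ,
                   λ rnz → ¬rn (subst Residue (⊗-cancel-inverse n zu≡𝟙) (Residue-⊗ rnz (Residue-inverse rz zu≡𝟙)))

  [D]-square : ∀ y → [D] (y ⊗ y) ≡ 𝕀 (not (isZero y))
  [D]-square y with y ≟ 𝟘
  ... | yes refl = cong 𝕀 (dec-false (residue? (𝟘 ⊗ 𝟘)) (λ r → proj₁ r (⊗-zeroʳ 𝟘)))
  ... | no y≢𝟘   = cong 𝕀 (dec-true (residue? (y ⊗ y)) (Residue-square y≢𝟘))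

  -- Each residue has exactly the two square roots ±y₀, and they are distinct because p is odd.
  square-fibre : ∀ x → sum (λ y → δ x (y ⊗ y) * [D] x) ≡ 2 * [D] x
  square-fibre x with isResidue x in r
  ... | false = trans (sum-cong-≗ (λ y → *-zeroʳ (δ x (y ⊗ y)))) (sum-replicate-zero p)
  ... | true with does-true⁻ (residue? x) r
  ...   | x≢𝟘 , y₀ , y₀y₀≡x = begin
    sum (λ y → δ x (y ⊗ y) * 1)             ≡⟨ sum-cong-≗ (λ y → trans (*-identityʳ _) (δ-square y)) ⟩
    sum (λ y → δ y y₀ + δ y (⊖ y₀))          ≡⟨ ∑-distrib-+ (λ y → δ y y₀) (λ y → δ y (⊖ y₀)) ⟩
    sum (λ y → δ y y₀) + sum (λ y → δ y (⊖ y₀)) ≡⟨ cong₂ _+_ (sum-δ₁ y₀) (sum-δ₁ (⊖ y₀)) ⟩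
    2                                        ∎
    where
    open ≡-Reasoning
    y₀≢𝟘 : y₀ ≢ 𝟘
    y₀≢𝟘 refl = x≢𝟘 (trans (sym y₀y₀≡x) (⊗-zeroʳ 𝟘))
    δ-square : ∀ y → δ x (y ⊗ y) ≡ δ y y₀ + δ y (⊖ y₀)
    δ-square y with y ≟ y₀ | y ≟ ⊖ y₀
    ... | yes refl | yes y≡-y = ⊥-elim (≢⊖-self 2<p y₀≢𝟘 y≡-y)
    ... | yes refl | no _     = δ-≡ (sym y₀y₀≡x)
    ... | no _     | yes refl = δ-≡ (trans (sym y₀y₀≡x) (solve 1 (λ y → y :* y := (:- y) :* (:- y)) refl y₀))
    ... | no y≢y₀  | no y≢-y₀ = δ-≢ (λ x≡yy → Sum.[ y≢y₀ , y≢-y₀ ] (squares-≡ y y₀ (trans (sym x≡yy) (sym y₀y₀≡x))))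

  p≡1+2#D : p ≡ 1 + 2 * #D
  p≡1+2#D = begin
    p                                         ≡⟨ sym (*-identityʳ p) ⟩
    p * 1                                     ≡⟨ sym (sum-const p 1) ⟩
    sum {p} (λ _ → 1)                         ≡⟨ sum-cong-≗ (λ y → sym (𝕀-+-𝕀-not (isZero y))) ⟩
    sum (λ y → [0] y + 𝕀 (not (isZero y)))    ≡⟨ ∑-distrib-+ [0] (λ y → 𝕀 (not (isZero y))) ⟩
    sum [0] + sum (λ y → 𝕀 (not (isZero y)))  ≡⟨ cong₂ _+_ (sum-δ₁ 𝟘) nonzero-count ⟩
    1 + 2 * #D                                ∎
    where
    open ≡-Reasoning
    nonzero-count : sum (λ y → 𝕀 (not (isZero y))) ≡ 2 * #D
    nonzero-count = begin
      sum (λ y → 𝕀 (not (isZero y)))                  ≡⟨ sum-cong-≗ (λ y → sym ([D]-square y)) ⟩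
      sum (λ y → [D] (y ⊗ y))                         ≡⟨ sum-cong-≗ (λ y → sym (sum-δ (y ⊗ y) [D])) ⟩
      sum (λ y → sum (λ x → δ x (y ⊗ y) * [D] x))     ≡⟨ ∑-comm (λ y x → δ x (y ⊗ y) * [D] x) ⟩
      sum (λ x → sum (λ y → δ x (y ⊗ y) * [D] x))     ≡⟨ sum-cong-≗ square-fibre ⟩
      sum (λ x → 2 * [D] x)                           ≡⟨ sym (*-distribˡ-sum 2 [D]) ⟩
      2 * #D                                          ∎

  #N≡#D : #N ≡ #D
  #N≡#D = +-cancelˡ-≡ (1 + #D) #N #D (begin
    1 + #D + #N            ≡⟨ cong (λ k → k + #D + #N) (sym (sum-δ₁ 𝟘)) ⟩
    sum [0] + #D + #N      ≡⟨ cong (_+ #N) (sym (∑-distrib-+ [0] [D])) ⟩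
    sum (λ x → [0] x + [D] x) + #N         ≡⟨ sym (∑-distrib-+ (λ x → [0] x + [D] x) [N]) ⟩
    sum (λ x → [0] x + [D] x + [N] x)      ≡⟨ sum-cong-≗ trichotomy ⟩
    sum {p} (λ _ → 1)                      ≡⟨ trans (sum-const p 1) (*-identityʳ p) ⟩
    p                                      ≡⟨ p≡1+2#D ⟩
    1 + (#D + (#D + 0))                    ≡⟨ cong (λ k → 1 + (#D + k)) (+-identityʳ #D) ⟩
    1 + #D + #D                            ∎)
    where open ≡-Reasoning

  -- Multiplication by a nonresidue maps D into N; since #D ≡ #N it maps D onto N.
  [D]≡[N]∘⊗-NonResidue : ∀ {n} → NonResidue n → ∀ z → [D] z ≡ [N] (n ⊗ z)
  [D]≡[N]∘⊗-NonResidue {n} rn with ⊗-inverse n (proj₁ rn)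
  ... | u , nu≡𝟙 = sum-≤-≡⇒≗ [D]≤[N]∘⊗ (trans (sym #N≡#D) (sym (sum-∘-⊗ n u nu≡𝟙 [N])))
    where
    [D]≤[N]∘⊗ : ∀ z → [D] z ≤ [N] (n ⊗ z)
    [D]≤[N]∘⊗ z with isResidue z in r
    ... | false = z≤n
    ... | true  = ≤-reflexive (cong 𝕀 (sym (dec-true (nonResidue? (n ⊗ z))
                    (NonResidue-⊗-Residue rn (does-true⁻ (residue? z) r)))))

  isNonResidue-⊗-NonResidue : ∀ {n} → NonResidue n → ∀ z → isNonResidue (n ⊗ z) ≡ isResidue z
  isNonResidue-⊗-NonResidue rn z = 𝕀-injective (sym ([D]≡[N]∘⊗-NonResidue rn z))

  isResidue-⊗-NonResidue : ∀ {n} → NonResidue n → ∀ z → isResidue (n ⊗ z) ≡ isNonResidue z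
  isResidue-⊗-NonResidue {n} rn z = 𝕀-injective (+-cancelˡ-≡ ([0] z + [D] z) _ _ (begin
    [0] z + [D] z + [D] (n ⊗ z)              ≡⟨ swap-last ([0] z) ([D] z) ([D] (n ⊗ z)) ⟩
    [0] z + [D] (n ⊗ z) + [D] z              ≡⟨ cong₂ (λ a b → 𝕀 a + [D] (n ⊗ z) + b)
                                                  (sym (isZero-⊗ z (proj₁ rn))) ([D]≡[N]∘⊗-NonResidue rn z) ⟩
    [0] (n ⊗ z) + [D] (n ⊗ z) + [N] (n ⊗ z)  ≡⟨ trichotomy (n ⊗ z) ⟩
    1                                        ≡⟨ sym (trichotomy z) ⟩
    [0] z + [D] z + [N] z                    ∎))
    where
    open ≡-Reasoning
    swap-last : ∀ a b c → a + b + c ≡ a + c + b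
    swap-last = solve-∀

  NonResidue-⊗ : ∀ {n m} → NonResidue n → NonResidue m → Residue (n ⊗ m)
  NonResidue-⊗ {n} {m} rn rm =
    does-true⁻ (residue? (n ⊗ m)) (trans (isResidue-⊗-NonResidue rn m) (dec-true (nonResidue? m) rm))

  NonResidue-inverse : ∀ {n u} → NonResidue n → n ⊗ u ≡ 𝟙 → NonResidue u
  NonResidue-inverse {n} {u} rn nu≡𝟙 = does-true⁻ (nonResidue? u)
    (trans (sym (isResidue-⊗-NonResidue rn u)) (trans (cong isResidue nu≡𝟙) (dec-true (residue? 𝟙) Residue-𝟙)))

  shared : Fin p → ℕ
  shared a = sum (λ x → [D] (x ⊕ ⊖ a) * [D] x)

  shared-⊗-Residue : ∀ {d} a → Residue d → shared (d ⊗ a) ≡ shared a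
  shared-⊗-Residue {d} a rd with ⊗-inverse d (proj₁ rd)
  ... | u , du≡𝟙 = begin
    sum (λ x → [D] (x ⊕ ⊖ (d ⊗ a)) * [D] x)          ≡⟨ sym (sum-∘-⊗ d u du≡𝟙 (λ x → [D] (x ⊕ ⊖ (d ⊗ a)) * [D] x)) ⟩
    sum (λ x → [D] (d ⊗ x ⊕ ⊖ (d ⊗ a)) * [D] (d ⊗ x)) ≡⟨ sum-cong-≗ (λ x → cong₂ _*_ (scaled x) (cong 𝕀 (isResidue-⊗ x rd))) ⟩
    sum (λ x → [D] (x ⊕ ⊖ a) * [D] x)                ∎
    where
    open ≡-Reasoning
    scaled : ∀ x → [D] (d ⊗ x ⊕ ⊖ (d ⊗ a)) ≡ [D] (x ⊕ ⊖ a)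
    scaled x = trans (cong [D] (solve 3 (λ d x a → d :* x :+ :- (d :* a) := d :* (x :+ :- a)) refl d x a))
                     (cong 𝕀 (isResidue-⊗ (x ⊕ ⊖ a) rd))

  shared-⊖ : ∀ a → shared (⊖ a) ≡ shared a
  shared-⊖ a = begin
    sum (λ x → [D] (x ⊕ ⊖ ⊖ a) * [D] x)                 ≡⟨ sym (sum-∘-⊕ (⊖ a) (λ x → [D] (x ⊕ ⊖ ⊖ a) * [D] x)) ⟩
    sum (λ x → [D] (x ⊕ ⊖ a ⊕ ⊖ ⊖ a) * [D] (x ⊕ ⊖ a))   ≡⟨ sum-cong-≗ (λ x → trans (cong (λ z → [D] z * [D] (x ⊕ ⊖ a))
                                                            (solve 2 (λ x a → x :+ :- a :+ :- (:- a) := x) refl x a))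
                                                            (*-comm ([D] x) _)) ⟩
    sum (λ x → [D] (x ⊕ ⊖ a) * [D] x)                   ∎
    where open ≡-Reasoning

  shared-𝟘 : shared 𝟘 ≡ #D
  shared-𝟘 = sum-cong-≗ (λ x → trans (cong (λ z → [D] z * [D] x) (⊕-⊖𝟘 x)) (𝕀-idem (isResidue x)))

  sum-shared : sum shared ≡ #D * #D
  sum-shared = begin
    sum (λ a → sum (λ x → [D] (x ⊕ ⊖ a) * [D] x))  ≡⟨ ∑-comm (λ a x → [D] (x ⊕ ⊖ a) * [D] x) ⟩
    sum (λ x → sum (λ a → [D] (x ⊕ ⊖ a) * [D] x))  ≡⟨ sum-cong-≗ (λ x → trans (sym (*-distribʳ-sum ([D] x) (λ a → [D] (x ⊕ ⊖ a))))
                                                                            (cong (_* [D] x) (sum-∘-reflect x [D]))) ⟩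
    sum (λ x → #D * [D] x)                         ≡⟨ sym (*-distribˡ-sum #D [D]) ⟩
    #D * #D                                        ∎
    where open ≡-Reasoning

  shared-Residue : ∀ {a} → Residue a → shared a ≡ shared 𝟙
  shared-Residue {a} ra = trans (cong shared (sym (⊗-identityʳ a))) (shared-⊗-Residue 𝟙 ra)

  shared-NonResidue : ∀ {n a} → NonResidue n → NonResidue a → shared a ≡ shared n
  shared-NonResidue {n} {a} rn ra with ⊗-inverse n (proj₁ rn)
  ... | u , nu≡𝟙 = trans (cong shared (sym a⊗u⊗n≡a))
                         (shared-⊗-Residue n (NonResidue-⊗ ra (NonResidue-inverse rn nu≡𝟙)))
    where
    a⊗u⊗n≡a : a ⊗ u ⊗ n ≡ a
    a⊗u⊗n≡a = ⊗-cancel-inverse a (trans (⊗-comm u n) nu≡𝟙)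

  #D≡1+A+B : ∀ {A B} → (∀ {a} → Residue a → shared a ≡ A) → (∀ {a} → NonResidue a → shared a ≡ B) →
             0 < #D → #D ≡ 1 + A + B
  #D≡1+A+B {A} {B} onD onN #D>0 = *-cancelˡ-≡ #D (1 + A + B) #D {{>-nonZero #D>0}} (begin
    #D * #D                                                     ≡⟨ sym sum-shared ⟩
    sum shared                                                  ≡⟨ sum-cong-≗ split ⟩
    sum (λ a → [0] a * shared a + [D] a * A + [N] a * B)        ≡⟨ ∑-distrib-+ (λ a → [0] a * shared a + [D] a * A) (λ a → [N] a * B) ⟩
    sum (λ a → [0] a * shared a + [D] a * A) + sum (λ a → [N] a * B)
                                                                ≡⟨ cong (_+ sum (λ a → [N] a * B)) (∑-distrib-+ (λ a → [0] a * shared a) (λ a → [D] a * A)) ⟩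
    sum (λ a → [0] a * shared a) + sum (λ a → [D] a * A) + sum (λ a → [N] a * B)
                                                                ≡⟨ cong₂ (λ u v → u + v + sum (λ a → [N] a * B))
                                                                     (trans (sum-δ 𝟘 shared) shared-𝟘) (sym (*-distribʳ-sum A [D])) ⟩
    #D + #D * A + sum (λ a → [N] a * B)                         ≡⟨ cong (#D + #D * A +_) (trans (sym (*-distribʳ-sum B [N])) (cong (_* B) #N≡#D)) ⟩
    #D + #D * A + #D * B                                        ≡⟨ sym (distribute #D A B) ⟩
    #D * (1 + A + B)                                            ∎)
    where
    open ≡-Reasoning
    distribute : ∀ h a b → h * (1 + a + b) ≡ h + h * a + h * b
    distribute = solve-∀
    weighted : ∀ b {m n} → (b ≡ true → m ≡ n) → 𝕀 b * m ≡ 𝕀 b * n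
    weighted true  m≡n = cong (_+ 0) (m≡n refl)
    weighted false _   = refl
    split : ∀ a → shared a ≡ [0] a * shared a + [D] a * A + [N] a * B
    split a = trans (sym (weighted-trichotomy a (shared a)))
      (cong₂ (λ u v → [0] a * shared a + u + v) (weighted (isResidue a) (onD ∘ does-true⁻ (residue? a)))
                                                (weighted (isNonResidue a) (onN ∘ does-true⁻ (nonResidue? a))))

module Paley (p : ℕ) .{{_ : NonZero p}} (p-prime : Prime p) (p%4≡1 : p % 4 ≡ 1) (5<p : 5 < p) where

  open QuadraticResidues p p-prime (<-trans (s≤s (s≤s (s≤s z≤n))) 5<p) public

  q : ℕ
  q = p / 4

  #D≡2q : #D ≡ 2 * q
  #D≡2q = 1+2h≡1mod4⇒h≡2[p/4] p #D p≡1+2#D p%4≡1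

  #D>0 : 0 < #D
  #D>0 = subst (0 <_) (sym #D≡2q) (≤-trans (s≤s z≤n) (≤-trans (1mod4∧5<p⇒2≤p/4 p p%4≡1 5<p) (m≤n*m q 2)))

  -- If −1 were a nonresidue, every a ≠ 0 would satisfy shared a ≡ shared (−a) ≡ shared 1,
  -- making #D ≡ 1 + 2 · shared 1 odd.
  Residue-⊖𝟙 : Residue (⊖ 𝟙)
  Residue-⊖𝟙 with residue? (⊖ 𝟙)
  ... | yes r = r
  ... | no ¬r = ⊥-elim (even≢odd q (shared 𝟙) (trans (sym #D≡2q) (trans (#D≡1+A+B shared-Residue onN #D>0) (odd (shared 𝟙)))))
    where
    ⊖𝟙≢𝟘 : ⊖ 𝟙 ≢ 𝟘
    ⊖𝟙≢𝟘 e = 𝟙≢𝟘 (trans (sym (-‿involutive 𝟙)) (trans (cong ⊖_ e) -0#≈0#))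
    onN : ∀ {a} → NonResidue a → shared a ≡ shared 𝟙
    onN {a} ra = begin
      shared a          ≡⟨ sym (shared-⊖ a) ⟩
      shared (⊖ a)      ≡⟨ cong shared (solve 1 (λ a → :- a := (:- con ℤ.1ℤ) :* a) refl a) ⟩
      shared (⊖ 𝟙 ⊗ a)  ≡⟨ shared-Residue (NonResidue-⊗ (⊖𝟙≢𝟘 , ¬r) ra) ⟩
      shared 𝟙          ∎
      where open ≡-Reasoning
    odd : ∀ a → 1 + a + a ≡ suc (2 * a)
    odd = solve-∀

  nonResidue-exists : ∃ NonResidue
  nonResidue-exists with sum-positive [N] (subst (0 <_) (sym #N≡#D) #D>0)
  ... | n , [N]n>0 = n , does-true⁻ (nonResidue? n) (𝕀-positive [N]n>0)

  module _ {n : Fin p} (rn : NonResidue n) where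

    #DN : ℕ
    #DN = sum (λ x → [D] (x ⊕ ⊖ n) * [N] x)

    -- Multiplying by n exchanges D and N.
    NN-count : sum (λ x → [N] (x ⊕ ⊖ n) * [N] x) ≡ shared 𝟙
    NN-count = begin
      sum (λ x → [N] (x ⊕ ⊖ n) * [N] x)           ≡⟨ sym (sum-∘-⊗ n u nu≡𝟙 (λ x → [N] (x ⊕ ⊖ n) * [N] x)) ⟩
      sum (λ x → [N] (n ⊗ x ⊕ ⊖ n) * [N] (n ⊗ x)) ≡⟨ sum-cong-≗ (λ x → cong₂ _*_ (scaled x)
                                                       (cong 𝕀 (isNonResidue-⊗-NonResidue rn x))) ⟩
      sum (λ x → [D] (x ⊕ ⊖ 𝟙) * [D] x)           ∎
      where
      open ≡-Reasoning
      u = proj₁ (⊗-inverse n (proj₁ rn))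
      nu≡𝟙 = proj₂ (⊗-inverse n (proj₁ rn))
      scaled : ∀ x → [N] (n ⊗ x ⊕ ⊖ n) ≡ [D] (x ⊕ ⊖ 𝟙)
      scaled x = trans (cong [N] (solve 2 (λ n x → n :* x :+ :- n := n :* (x :+ :- con ℤ.1ℤ)) refl n x))
                       (cong 𝕀 (isNonResidue-⊗-NonResidue rn (x ⊕ ⊖ 𝟙)))

    -- Split the nonresidues x by the class of x − n.
    1+#DN+A≡#D : 1 + #DN + shared 𝟙 ≡ #D
    1+#DN+A≡#D = begin
      1 + #DN + shared 𝟙               ≡⟨ cong₂ (λ a b → a + #DN + b) (sym ZN-count) (sym NN-count) ⟩
      sum ZN + #DN + sum NN            ≡⟨ cong (_+ sum NN) (sym (∑-distrib-+ ZN DN)) ⟩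
      sum (λ x → ZN x + DN x) + sum NN ≡⟨ sym (∑-distrib-+ (λ x → ZN x + DN x) NN) ⟩
      sum (λ x → ZN x + DN x + NN x)   ≡⟨ sum-cong-≗ (λ x → weighted-trichotomy (x ⊕ ⊖ n) ([N] x)) ⟩
      #N                               ≡⟨ #N≡#D ⟩
      #D                               ∎
      where
      open ≡-Reasoning
      ZN DN NN : Fin p → ℕ
      ZN x = [0] (x ⊕ ⊖ n) * [N] x
      DN x = [D] (x ⊕ ⊖ n) * [N] x
      NN x = [N] (x ⊕ ⊖ n) * [N] x
      [0]-shift : ∀ x → [0] (x ⊕ ⊖ n) ≡ δ x n
      [0]-shift x = cong 𝕀 (does-⇔ (mk⇔ (x∙y⁻¹≈ε⇒x≈y x n) (λ x≡n → trans (cong (_⊕ ⊖ n) x≡n) (⊖-inverseʳ n)))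
                                    (x ⊕ ⊖ n ≟ 𝟘) (x ≟ n))
      ZN-count : sum ZN ≡ 1
      ZN-count = trans (sum-cong-≗ (λ x → cong (_* [N] x) ([0]-shift x)))
                       (trans (sum-δ n [N]) (cong 𝕀 (dec-true (nonResidue? n) rn)))

    -- Split the residues x by the class of x + n, which is never 0 because −n is a nonresidue.
    #DN+B≡#D : #DN + shared n ≡ #D
    #DN+B≡#D = begin
      #DN + shared n                                        ≡⟨ cong₂ _+_ (sym (sum-∘-⊕ n (λ x → [D] (x ⊕ ⊖ n) * [N] x)))
                                                                         (sym (shared-⊖ n)) ⟩
      sum (λ x → [D] (x ⊕ n ⊕ ⊖ n) * [N] (x ⊕ n)) + shared (⊖ n)
                                                            ≡⟨ cong₂ _+_ (sum-cong-≗ (λ x → cong (λ z → [D] z * [N] (x ⊕ n))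
                                                                 (solve 2 (λ x n → x :+ n :+ :- n := x) refl x n)))
                                                                 (sum-cong-≗ (λ x → cong (λ z → [D] (x ⊕ z) * [D] x) (-‿involutive n))) ⟩
      sum (λ x → [D] x * [N] (x ⊕ n)) + sum (λ x → [D] (x ⊕ n) * [D] x)
                                                            ≡⟨ sym (∑-distrib-+ (λ x → [D] x * [N] (x ⊕ n)) (λ x → [D] (x ⊕ n) * [D] x)) ⟩
      sum (λ x → [D] x * [N] (x ⊕ n) + [D] (x ⊕ n) * [D] x) ≡⟨ sum-cong-≗ pointwise ⟩
      #D                                                    ∎
      where
      open ≡-Reasoning
      pointwise : ∀ x → [D] x * [N] (x ⊕ n) + [D] (x ⊕ n) * [D] x ≡ [D] x
      pointwise x with isResidue x in r
      ... | false = *-zeroʳ ([D] (x ⊕ n))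
      ... | true  = begin
        [N] y + 0 + [D] y * 1  ≡⟨ cong₂ _+_ (+-identityʳ ([N] y)) (*-identityʳ ([D] y)) ⟩
        [N] y + [D] y          ≡⟨ +-comm ([N] y) ([D] y) ⟩
        [D] y + [N] y          ≡⟨ cong (λ b → 𝕀 b + [D] y + [N] y) (sym y≢𝟘) ⟩
        [0] y + [D] y + [N] y  ≡⟨ trichotomy y ⟩
        1                      ∎
        where
        y = x ⊕ n
        y≢𝟘 : isZero y ≡ false
        y≢𝟘 = dec-false (y ≟ 𝟘) (λ y≡𝟘 → proj₂ rn (subst Residue (−x≡n y≡𝟘) (Residue-⊗ Residue-⊖𝟙 (does-true⁻ (residue? x) r))))
          where
          −x≡n : y ≡ 𝟘 → ⊖ 𝟙 ⊗ x ≡ n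
          −x≡n y≡𝟘 = trans (solve 1 (λ x → (:- con ℤ.1ℤ) :* x := :- x) refl x)
                            (trans (cong ⊖_ (+-inverseˡ-unique x n y≡𝟘)) (-‿involutive n))

    shared-NonResidue≡1+A : shared n ≡ 1 + shared 𝟙
    shared-NonResidue≡1+A = +-cancelˡ-≡ #DN (shared n) (1 + shared 𝟙)
      (trans #DN+B≡#D (trans (sym 1+#DN+A≡#D) (rearrange #DN (shared 𝟙))))
      where
      rearrange : ∀ y a → 1 + y + a ≡ y + (1 + a)
      rearrange = solve-∀

  q≡1+A : q ≡ 1 + shared 𝟙
  q≡1+A with nonResidue-exists
  ... | n , rn = *-cancelˡ-≡ q (1 + A) 2 (begin
    2 * q              ≡⟨ sym #D≡2q ⟩
    #D                 ≡⟨ #D≡1+A+B shared-Residue (shared-NonResidue rn) #D>0 ⟩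
    1 + A + shared n   ≡⟨ cong (1 + A +_) (shared-NonResidue≡1+A rn) ⟩
    1 + A + (1 + A)    ≡⟨ double A ⟩
    2 * (1 + A)        ∎)
    where
    open ≡-Reasoning
    A = shared 𝟙
    double : ∀ a → 1 + a + (1 + a) ≡ 2 * (1 + a)
    double = solve-∀

module PaleyAdesign (p : ℕ) .{{_ : NonZero p}} (p-prime : Prime p) (p%4≡1 : p % 4 ≡ 1) (5<p : 5 < p) where

  open Paley p p-prime p%4≡1 5<p

  r : ℕ
  r = q ∸ 2

  q≡2+r : q ≡ 2 + r
  q≡2+r = trans (sym (m∸n+n≡m (1mod4∧5<p⇒2≤p/4 p p%4≡1 5<p))) (+-comm r 2)

  shared-Residue≡1+r : ∀ {a} → Residue a → shared a ≡ 1 + r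
  shared-Residue≡1+r ra = trans (shared-Residue ra) (suc-injective (trans (sym q≡1+A) q≡2+r))

  shared-NonResidue≡2+r : ∀ {a} → NonResidue a → shared a ≡ 2 + r
  shared-NonResidue≡2+r ra = trans (shared-NonResidue≡1+A ra) (cong suc (shared-Residue≡1+r Residue-𝟙))

  #D≡2+r+[2+r] : #D ≡ (2 + r) + (2 + r)
  #D≡2+r+[2+r] = trans #D≡2q (trans (cong (q +_) (+-identityʳ q)) (cong₂ _+_ q≡2+r q≡2+r))

  p≡1+[2+r]*4 : p ≡ 1 + (2 + r) * 4
  p≡1+[2+r]*4 = trans (m≡m%n+[m/n]*n p 4) (cong₂ _+_ p%4≡1 (cong (_* 4) q≡2+r))

  [p-1]/4≡2+r : (p ∸ 1) / 4 ≡ 2 + r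
  [p-1]/4≡2+r = proj₁ (quarters p r p≡1+[2+r]*4)

  [p-5]/4≡1+r : (p ∸ 5) / 4 ≡ 1 + r
  [p-5]/4≡1+r = proj₁ (proj₂ (quarters p r p≡1+[2+r]*4))

  [p-9]/4≡r : (p ∸ 9) / 4 ≡ r
  [p-9]/4≡r = proj₂ (proj₂ (quarters p r p≡1+[2+r]*4))

  shared<#D : ∀ {a} → a ≢ 𝟘 → shared a < #D
  shared<#D {a} a≢𝟘 with classify a
  ... | zero a≡𝟘       = ⊥-elim (a≢𝟘 a≡𝟘)
  ... | residue ra     = subst₂ _<_ (sym (shared-Residue≡1+r ra)) (sym #D≡2+r+[2+r]) (m≤m+n (2 + r) (2 + r))
  ... | nonResidue ra  = subst₂ _<_ (sym (shared-NonResidue≡2+r ra)) (sym #D≡2+r+[2+r]) (m<m+n (2 + r) (s≤s z≤n))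

  subₚ≡⊕⊖ : ∀ x g → subₚ p x g ≡ x ⊕ ⊖ g
  subₚ≡⊕⊖ x g = sym (⊕-⟦⟧ x (p ∸ toℕ g))

  opaque
    unfolding residue?

    lookup-QR : ∀ x → lookup (QR p) x ≡ isResidue x
    lookup-QR x = trans (Vecₚ.lookup∘tabulate _ x) (isYes≗does (isQR? p x))

  lookup-translate : ∀ g x → lookup (translate p g) x ≡ isResidue (x ⊕ ⊖ g)
  lookup-translate g x = trans (Vecₚ.lookup∘tabulate _ x) (trans (lookup-QR (subₚ p x g)) (cong isResidue (subₚ≡⊕⊖ x g)))

  block : Fin p → Subset p
  block g = translate p g ∩ QR p

  lookup-block : ∀ g x → lookup (block g) x ≡ isResidue (x ⊕ ⊖ g) ∧ isResidue x
  lookup-block g x = trans (Vecₚ.lookup-zipWith _∧_ x (translate p g) (QR p))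
                           (cong₂ _∧_ (lookup-translate g x) (lookup-QR x))

  ∣block∣≡shared : ∀ g → ∣ block g ∣ ≡ shared g
  ∣block∣≡shared g = trans (∣∣≡sum-lookup (block g))
    (sum-cong-≗ (λ x → trans (cong 𝕀 (lookup-block g x)) (𝕀-∧ (isResidue (x ⊕ ⊖ g)) (isResidue x))))

  translate-𝟘 : translate p 𝟘 ≡ QR p
  translate-𝟘 = Vecₚ.tabulate-cong (λ x →
    trans (cong (lookup (QR p)) (trans (subₚ≡⊕⊖ x 𝟘) (⊕-⊖𝟘 x))) (Vecₚ.lookup∘tabulate _ x))

  translate≢QR : ∀ {g} → g ≢ 𝟘 → translate p g ≢ QR p
  translate≢QR {g} g≢𝟘 Dg≡D = <-irrefl shared≡#D (shared<#D g≢𝟘)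
    where
    shared≡#D : shared g ≡ #D
    shared≡#D = sum-cong-≗ (λ x → trans (cong (λ b → 𝕀 b * [D] x)
                  (trans (sym (lookup-translate g x)) (trans (cong (λ v → lookup v x) Dg≡D) (lookup-QR x))))
                  (𝕀-idem (isResidue x)))

  blockOf-++ : ∀ g rest → blockOf p g rest ≡ blockOf p g [] ++ rest
  blockOf-++ g rest with ≡-dec Bool._≟_ (translate p g) (QR p)
  ... | yes _ = refl
  ... | no _ with ∣ translate p g ∩ QR p ∣ ℕ.≟ (p ∸ 1) / 4
  ...   | yes _ = refl
  ...   | no _ with ∣ translate p g ∩ QR p ∣ ℕ.≟ (p ∸ 5) / 4
  ...     | yes _ = refl
  ...     | no _  = refl

  blockOf-𝟘 : ∀ rest → blockOf p 𝟘 rest ≡ rest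
  blockOf-𝟘 rest with ≡-dec Bool._≟_ (translate p 𝟘) (QR p)
  ... | yes _     = refl
  ... | no D+0≢D = ⊥-elim (D+0≢D translate-𝟘)

  blockOf-NonResidue : ∀ {g} rest → NonResidue g → blockOf p g rest ≡ (block g ∷ʳ false) ∷ rest
  blockOf-NonResidue {g} rest rg with ≡-dec Bool._≟_ (translate p g) (QR p)
  ... | yes D+g≡D = ⊥-elim (translate≢QR (proj₁ rg) D+g≡D)
  ... | no _ with ∣ block g ∣ ℕ.≟ (p ∸ 1) / 4
  ...   | yes _     = refl
  ...   | no size≢ = ⊥-elim (size≢ (trans (∣block∣≡shared g) (trans (shared-NonResidue≡2+r rg) (sym [p-1]/4≡2+r))))

  blockOf-Residue : ∀ {g} rest → Residue g → blockOf p g rest ≡ (block g ∷ʳ true) ∷ rest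
  blockOf-Residue {g} rest rg with ≡-dec Bool._≟_ (translate p g) (QR p)
  ... | yes D+g≡D = ⊥-elim (translate≢QR (proj₁ rg) D+g≡D)
  ... | no _ with ∣ block g ∣ ℕ.≟ (p ∸ 1) / 4
  ...   | yes size≡ = ⊥-elim (1+n≢n (trans (sym (trans size≡ [p-1]/4≡2+r)) (trans (∣block∣≡shared g) (shared-Residue≡1+r rg))))
  ...   | no _ with ∣ block g ∣ ℕ.≟ (p ∸ 5) / 4
  ...     | yes _     = refl
  ...     | no size≢ = ⊥-elim (size≢ (trans (∣block∣≡shared g) (trans (shared-Residue≡1+r rg) (sym [p-5]/4≡1+r))))

  blockCount-blockOf : ∀ T g → blockCount (blockOf p g []) T ≡ 𝕀 (not (isZero g)) * 𝕀 (does (T ⊆? block g ∷ʳ isResidue g))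
  blockCount-blockOf T g with classify g
  ... | zero refl =
    trans (cong (λ B → blockCount B T) (blockOf-𝟘 [])) (cong (λ z → 𝕀 (not z) * 𝕀 (does (T ⊆? block 𝟘 ∷ʳ isResidue 𝟘))) (sym (dec-true (𝟘 ≟ 𝟘) refl)))
  ... | residue rg = trans (cong (λ B → blockCount B T) (blockOf-Residue [] rg)) (trans (blockCount-[ _ ] T)
    (sym (trans (cong₂ (λ z b → 𝕀 (not z) * 𝕀 (does (T ⊆? block g ∷ʳ b))) (dec-false (g ≟ 𝟘) (proj₁ rg)) (dec-true (residue? g) rg))
                (+-identityʳ _))))
  ... | nonResidue rg = trans (cong (λ B → blockCount B T) (blockOf-NonResidue [] rg)) (trans (blockCount-[ _ ] T)
    (sym (trans (cong₂ (λ z b → 𝕀 (not z) * 𝕀 (does (T ⊆? block g ∷ʳ b))) (dec-false (g ≟ 𝟘) (proj₁ rg)) (dec-false (residue? g) (proj₂ rg)))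
                (+-identityʳ _))))

  blockCount-foldr : ∀ {n} (h : Fin n → Fin p) T →
                     blockCount (foldr (blockOf p) [] (List.tabulate h)) T ≡ sum (λ i → blockCount (blockOf p (h i) []) T)
  blockCount-foldr {zero}  h T = refl
  blockCount-foldr {suc n} h T = begin
    blockCount (blockOf p (h zero) rest) T                           ≡⟨ cong (λ B → blockCount B T) (blockOf-++ (h zero) rest) ⟩
    blockCount (blockOf p (h zero) [] ++ rest) T                     ≡⟨ blockCount-++ (blockOf p (h zero) []) rest T ⟩
    blockCount (blockOf p (h zero) []) T + blockCount rest T         ≡⟨ cong (blockCount (blockOf p (h zero) []) T +_) (blockCount-foldr (h ∘ suc) T) ⟩
    blockCount (blockOf p (h zero) []) T + sum (λ i → blockCount (blockOf p (h (suc i)) []) T) ∎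
    where
    open ≡-Reasoning
    rest = foldr (blockOf p) [] (List.tabulate (h ∘ suc))

  blockCount-blocksInfty : ∀ T → blockCount (blocksInfty p) T ≡ sum (λ g → 𝕀 (not (isZero g)) * 𝕀 (does (T ⊆? block g ∷ʳ isResidue g)))
  blockCount-blocksInfty T = trans (blockCount-foldr id T) (sum-cong-≗ (blockCount-blockOf T))

  BlockOf : Fin p → Subset (suc p) → Set
  BlockOf g b = (Residue g × b ≡ block g ∷ʳ true) ⊎ (NonResidue g × b ≡ block g ∷ʳ false)

  ∈-foldr : ∀ {n} (h : Fin n → Fin p) {b} → b ∈L foldr (blockOf p) [] (List.tabulate h) → ∃ λ g → BlockOf g b
  ∈-foldr {suc n} h {b} b∈ with ∈-++⁻ (blockOf p (h zero) []) (subst (b ∈L_) (blockOf-++ (h zero) _) b∈)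
  ... | inj₂ b∈rest = ∈-foldr (h ∘ suc) b∈rest
  ... | inj₁ b∈head with classify (h zero)
  ...   | zero h₀≡𝟘     = ⊥-elim (∉[] (subst (b ∈L_) (trans (cong (λ g → blockOf p g []) h₀≡𝟘) (blockOf-𝟘 [])) b∈head))
    where
    ∉[] : ¬ b ∈L []
    ∉[] ()
  ...   | residue rg    = h zero , inj₁ (rg , single (subst (b ∈L_) (blockOf-Residue [] rg) b∈head))
    where
    single : ∀ {c} → b ∈L c ∷ [] → b ≡ c
    single (here b≡c) = b≡c
  ...   | nonResidue rg = h zero , inj₂ (rg , single (subst (b ∈L_) (blockOf-NonResidue [] rg) b∈head))
    where
    single : ∀ {c} → b ∈L c ∷ [] → b ≡ c
    single (here b≡c) = b≡c

  isResidue-⊖-comm : ∀ x g → isResidue (x ⊕ ⊖ g) ≡ isResidue (g ⊕ ⊖ x)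
  isResidue-⊖-comm x g = trans (sym (isResidue-⊗ (x ⊕ ⊖ g) Residue-⊖𝟙))
    (cong isResidue (solve 2 (λ x g → (:- con ℤ.1ℤ) :* (x :+ :- g) := g :+ :- x) refl x g))

  isResidue⇒¬isZero : ∀ g → isResidue g ≡ true → isZero g ≡ false
  isResidue⇒¬isZero g e = dec-false (g ≟ 𝟘) (proj₁ (does-true⁻ (residue? g) e))

  -- A pair {x, ∞} lies in the blocks of the residues g with x − g ∈ D.
  blockCount-through-∞ : ∀ {w : Subset p} {x} → (∀ i → lookup w i ≡ true → i ≡ x) → lookup w x ≡ true → Residue x →
                         blockCount (blocksInfty p) (w ∷ʳ true) ≡ 1 + r
  blockCount-through-∞ {w} {x} only-x x∈w rx = begin
    blockCount (blocksInfty p) (w ∷ʳ true)                                   ≡⟨ blockCount-blocksInfty (w ∷ʳ true) ⟩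
    sum (λ g → 𝕀 (not (isZero g)) * 𝕀 (does (w ∷ʳ true ⊆? block g ∷ʳ isResidue g))) ≡⟨ sum-cong-≗ pointwise ⟩
    shared x                                                                 ≡⟨ shared-Residue≡1+r rx ⟩
    1 + r                                                                    ∎
    where
    open ≡-Reasoning
    through-∞ : ∀ z a b → (b ≡ true → z ≡ false) → 𝕀 (not z) * 𝕀 ((a ∧ true) ∧ b) ≡ 𝕀 a * 𝕀 b
    through-∞ z     a     false _ = trans (cong (λ c → 𝕀 (not z) * 𝕀 c) (∧-zeroʳ (a ∧ true)))
                                          (trans (*-zeroʳ (𝕀 (not z))) (sym (*-zeroʳ (𝕀 a))))
    through-∞ z     false true  b⇒z = cong (λ z → 𝕀 (not z) * 0) (b⇒z refl)
    through-∞ z     true  true  b⇒z = cong (λ z → 𝕀 (not z) * 1) (b⇒z refl)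
    pointwise : ∀ g → 𝕀 (not (isZero g)) * 𝕀 (does (w ∷ʳ true ⊆? block g ∷ʳ isResidue g)) ≡ [D] (g ⊕ ⊖ x) * [D] g
    pointwise g = trans (cong (λ b → 𝕀 (not (isZero g)) * 𝕀 b) (begin
        does (w ∷ʳ true ⊆? block g ∷ʳ isResidue g)                  ≡⟨ ∷ʳ-⊆?-∷ʳ w (block g) true (isResidue g) ⟩
        does (w ⊆? block g) ∧ isResidue g                           ≡⟨ cong (_∧ isResidue g) (⊆?-singleton w (block g) only-x x∈w) ⟩
        lookup (block g) x ∧ isResidue g                            ≡⟨ cong (_∧ isResidue g) (lookup-block g x) ⟩
        (isResidue (x ⊕ ⊖ g) ∧ isResidue x) ∧ isResidue g           ≡⟨ cong₂ (λ a b → (a ∧ b) ∧ isResidue g)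
                                                                         (isResidue-⊖-comm x g) (dec-true (residue? x) rx) ⟩
        (isResidue (g ⊕ ⊖ x) ∧ true) ∧ isResidue g                  ∎))
      (through-∞ (isZero g) (isResidue (g ⊕ ⊖ x)) (isResidue g) (isResidue⇒¬isZero g))

  -- A pair {x, y} of residues lies in the blocks of the g ≠ 0 with x − g, y − g ∈ D;
  -- adding g = 0 gives shared (x − y) after the substitution g = x − z.
  1+blockCount-avoiding-∞ : ∀ {w : Subset p} {x y} → (∀ i → lookup w i ≡ true → i ≡ x ⊎ i ≡ y) →
                            lookup w x ≡ true → lookup w y ≡ true → Residue x → Residue y →
                            1 + blockCount (blocksInfty p) (w ∷ʳ false) ≡ shared (x ⊕ ⊖ y)
  1+blockCount-avoiding-∞ {w} {x} {y} x-or-y x∈w y∈w rx ry = begin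
    1 + blockCount (blocksInfty p) (w ∷ʳ false)              ≡⟨ cong (1 +_) (trans (blockCount-blocksInfty (w ∷ʳ false)) (sum-cong-≗ pointwise)) ⟩
    1 + sum (λ g → 𝕀 (not (isZero g)) * F g)                 ≡⟨ cong (_+ sum (λ g → 𝕀 (not (isZero g)) * F g)) (sym (trans (sum-δ 𝟘 F) F𝟘≡1)) ⟩
    sum (λ g → [0] g * F g) + sum (λ g → 𝕀 (not (isZero g)) * F g)
                                                             ≡⟨ sym (∑-distrib-+ (λ g → [0] g * F g) (λ g → 𝕀 (not (isZero g)) * F g)) ⟩
    sum (λ g → [0] g * F g + 𝕀 (not (isZero g)) * F g)       ≡⟨ sum-cong-≗ (λ g → trans (sym (*-distribʳ-+ (F g) ([0] g) _))
                                                                  (trans (cong (_* F g) (𝕀-+-𝕀-not (isZero g))) (*-identityˡ (F g)))) ⟩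
    sum F                                                    ≡⟨ sym (sum-∘-reflect x F) ⟩
    sum (λ z → F (x ⊕ ⊖ z))                                  ≡⟨ sum-cong-≗ reflected ⟩
    shared (x ⊕ ⊖ y)                                         ∎
    where
    open ≡-Reasoning
    F : Fin p → ℕ
    F g = [D] (x ⊕ ⊖ g) * [D] (y ⊕ ⊖ g)
    F𝟘≡1 : F 𝟘 ≡ 1
    F𝟘≡1 = cong₂ (λ a b → 𝕀 a * 𝕀 b) (trans (cong isResidue (⊕-⊖𝟘 x)) (dec-true (residue? x) rx))
                                      (trans (cong isResidue (⊕-⊖𝟘 y)) (dec-true (residue? y) ry))
    both : ∀ a b → 𝕀 ((a ∧ true) ∧ (b ∧ true)) ≡ 𝕀 a * 𝕀 b
    both a b = trans (cong₂ (λ a b → 𝕀 (a ∧ b)) (∧-identityʳ a) (∧-identityʳ b)) (𝕀-∧ a b)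
    pointwise : ∀ g → 𝕀 (not (isZero g)) * 𝕀 (does (w ∷ʳ false ⊆? block g ∷ʳ isResidue g)) ≡ 𝕀 (not (isZero g)) * F g
    pointwise g = cong (𝕀 (not (isZero g)) *_) (trans (cong 𝕀 (begin
        does (w ∷ʳ false ⊆? block g ∷ʳ isResidue g)        ≡⟨ ∷ʳ-⊆?-∷ʳ w (block g) false (isResidue g) ⟩
        does (w ⊆? block g) ∧ true                         ≡⟨ ∧-identityʳ _ ⟩
        does (w ⊆? block g)                                ≡⟨ ⊆?-pair w (block g) x-or-y x∈w y∈w ⟩
        lookup (block g) x ∧ lookup (block g) y            ≡⟨ cong₂ _∧_ (lookup-block g x) (lookup-block g y) ⟩
        (isResidue (x ⊕ ⊖ g) ∧ isResidue x) ∧ (isResidue (y ⊕ ⊖ g) ∧ isResidue y)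
                                                           ≡⟨ cong₂ (λ a b → (isResidue (x ⊕ ⊖ g) ∧ a) ∧ (isResidue (y ⊕ ⊖ g) ∧ b))
                                                                (dec-true (residue? x) rx) (dec-true (residue? y) ry) ⟩
        (isResidue (x ⊕ ⊖ g) ∧ true) ∧ (isResidue (y ⊕ ⊖ g) ∧ true) ∎))
      (both (isResidue (x ⊕ ⊖ g)) (isResidue (y ⊕ ⊖ g))))
    reflected : ∀ z → F (x ⊕ ⊖ z) ≡ [D] (z ⊕ ⊖ (x ⊕ ⊖ y)) * [D] z
    reflected z = trans (cong₂ (λ a b → [D] a * [D] b)
                          (solve 2 (λ x z → x :+ :- (x :+ :- z) := z) refl x z)
                          (solve 3 (λ x y z → y :+ :- (x :+ :- z) := z :+ :- (x :+ :- y)) refl x y z))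
                        (*-comm ([D] z) _)

  ∣QR∣≡#D : ∣ QR p ∣ ≡ #D
  ∣QR∣≡#D = trans (∣∣≡sum-lookup (QR p)) (sum-cong-≗ (λ x → cong 𝕀 (lookup-QR x)))

  numPoints : ∣ points p ∣ ≡ (p + 1) / 2
  numPoints = trans (∣∷ʳ∣ (QR p) true)
    (trans (cong (_+ 1) ∣QR∣≡#D) (trans (+-comm #D 1) (sym ([1+2h+1]/2≡1+h p #D p≡1+2#D))))

  block⊆QR : ∀ g → block g ⊆ QR p
  block⊆QR g = lookup⇒⊆ (λ x x∈block → trans (lookup-QR x)
    (proj₂ (∧-true⁻ (isResidue (x ⊕ ⊖ g)) (isResidue x) (trans (sym (lookup-block g x)) x∈block))))

  blocksInP : ∀ b → b ∈L blocksInfty p → b ⊆ points p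
  blocksInP b b∈ with ∈-foldr id b∈
  ... | g , inj₁ (_ , refl) = ∷ʳ-⊆⁺ (block g) (QR p) true  true (block⊆QR g) id
  ... | g , inj₂ (_ , refl) = ∷ʳ-⊆⁺ (block g) (QR p) false true (block⊆QR g) (λ ())

  blockSize : ∀ b → b ∈L blocksInfty p → ∣ b ∣ ≡ (p ∸ 1) / 4
  blockSize b b∈ with ∈-foldr id b∈
  ... | g , inj₁ (rg , refl) = trans (∣∷ʳ∣ (block g) true)
    (trans (cong (_+ 1) (trans (∣block∣≡shared g) (shared-Residue≡1+r rg))) (trans (+-comm (1 + r) 1) (sym [p-1]/4≡2+r)))
  ... | g , inj₂ (rg , refl) = trans (∣∷ʳ∣ (block g) false)
    (trans (+-identityʳ ∣ block g ∣) (trans (∣block∣≡shared g) (trans (shared-NonResidue≡2+r rg) (sym [p-1]/4≡2+r))))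

  points-Residue : ∀ {w : Subset p} {t} → w ∷ʳ t ⊆ points p → ∀ i → lookup w i ≡ true → Residue i
  points-Residue {w} {t} T⊆ i i∈w =
    does-true⁻ (residue? i) (trans (sym (lookup-QR i)) (⊆⇒lookup (proj₁ (∷ʳ-⊆⁻ w (QR p) t true T⊆)) i i∈w))

  λ′ : ℕ
  λ′ = (p ∸ 9) / 4

  twoValues : ∀ T → T ⊆ points p → ∣ T ∣ ≡ 2 → (blockCount (blocksInfty p) T ≡ λ′) ⊎ (blockCount (blocksInfty p) T ≡ suc λ′)
  twoValues T T⊆ ∣T∣≡2 with initLast T
  ... | w , true , refl with sum-𝕀≡1 (lookup w) (trans (sym (∣∣≡sum-lookup w))
                               (suc-injective (trans (+-comm 1 ∣ w ∣) (trans (sym (∣∷ʳ∣ w true)) ∣T∣≡2))))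
  ...   | x , x∈w , only-x =
    inj₂ (trans (blockCount-through-∞ only-x x∈w (points-Residue T⊆ x x∈w)) (cong suc (sym [p-9]/4≡r)))
  twoValues T T⊆ ∣T∣≡2 | w , false , refl with sum-𝕀≡2 (lookup w) (trans (sym (∣∣≡sum-lookup w))
                               (trans (sym (+-identityʳ ∣ w ∣)) (trans (sym (∣∷ʳ∣ w false)) ∣T∣≡2)))
  ...   | x , y , x≢y , x∈w , y∈w , x-or-y with classify (x ⊕ ⊖ y)
  ...     | zero x-y≡𝟘      = ⊥-elim (x≢y (x∙y⁻¹≈ε⇒x≈y x y x-y≡𝟘))
  ...     | residue rd      = inj₁ (suc-injective (trans count (trans (shared-Residue≡1+r rd) (cong suc (sym [p-9]/4≡r)))))
    where count = 1+blockCount-avoiding-∞ x-or-y x∈w y∈w (points-Residue T⊆ x x∈w) (points-Residue T⊆ y y∈w)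
  ...     | nonResidue rd   = inj₂ (suc-injective (trans count (trans (shared-NonResidue≡2+r rd) (cong (2 +_) (sym [p-9]/4≡r)))))
    where count = 1+blockCount-avoiding-∞ x-or-y x∈w y∈w (points-Residue T⊆ x x∈w) (points-Residue T⊆ y y∈w)

  upperOccurs : ∃ λ T → T ⊆ points p × ∣ T ∣ ≡ 2 × blockCount (blocksInfty p) T ≡ suc λ′
  upperOccurs = ⁅ 𝟙 ⁆ ∷ʳ true , T⊆ , trans (∣∷ʳ∣ ⁅ 𝟙 ⁆ true) (cong (_+ 1) (∣⁅x⁆∣≡1 𝟙)) ,
                trans (blockCount-through-∞ only-𝟙 𝟙∈ Residue-𝟙) (cong suc (sym [p-9]/4≡r))
    where
    only-𝟙 : ∀ i → lookup ⁅ 𝟙 ⁆ i ≡ true → i ≡ 𝟙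
    only-𝟙 i e = x∈⁅y⁆⇒x≡y 𝟙 (Vecₚ.lookup⇒[]= i ⁅ 𝟙 ⁆ e)
    𝟙∈ : lookup ⁅ 𝟙 ⁆ 𝟙 ≡ true
    𝟙∈ = Vecₚ.[]=⇒lookup (x∈⁅x⁆ 𝟙)
    T⊆ : ⁅ 𝟙 ⁆ ∷ʳ true ⊆ points p
    T⊆ = ∷ʳ-⊆⁺ ⁅ 𝟙 ⁆ (QR p) true true
           (lookup⇒⊆ (λ i e → trans (lookup-QR i) (subst (λ z → isResidue z ≡ true) (sym (only-𝟙 i e)) (dec-true (residue? 𝟙) Residue-𝟙))))
           id

  pair-attaining-λ : ∀ {x y} → Residue x → Residue y → Residue (x ⊕ ⊖ y) →
                     ∃ λ T → T ⊆ points p × ∣ T ∣ ≡ 2 × blockCount (blocksInfty p) T ≡ λ′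
  pair-attaining-λ {x} {y} rx ry rx-y =
    pair x y ∷ʳ false , T⊆ , trans (∣∷ʳ∣ (pair x y) false) (trans (+-identityʳ _) (∣pair∣≡2 x≢y)) ,
    suc-injective (trans (1+blockCount-avoiding-∞ ∈pair⁻ (x∈pair x y) (y∈pair x y) rx ry)
                         (trans (shared-Residue≡1+r rx-y) (cong suc (sym [p-9]/4≡r))))
    where
    x≢y : x ≢ y
    x≢y refl = proj₁ rx-y (⊖-inverseʳ x)
    x∈D∨y∈D : ∀ i → i ≡ x ⊎ i ≡ y → isResidue i ≡ true
    x∈D∨y∈D i (inj₁ refl) = dec-true (residue? x) rx
    x∈D∨y∈D i (inj₂ refl) = dec-true (residue? y) ry
    T⊆ : pair x y ∷ʳ false ⊆ points p
    T⊆ = ∷ʳ-⊆⁺ (pair x y) (QR p) false true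
           (lookup⇒⊆ (λ i i∈ → trans (lookup-QR i) (x∈D∨y∈D i (∈pair⁻ i i∈)))) (λ ())

  -- Since shared 1 > 0 there are residues x and x − 1.
  lowerOccurs : ∃ λ T → T ⊆ points p × ∣ T ∣ ≡ 2 × blockCount (blocksInfty p) T ≡ λ′
  lowerOccurs = pair-attaining-λ (does-true⁻ (residue? x) (proj₂ x-1∈D×x∈D)) (does-true⁻ (residue? (x ⊕ ⊖ 𝟙)) (proj₁ x-1∈D×x∈D))
                  (subst Residue (sym x-[x-1]≡𝟙) Residue-𝟙)
    where
    witness : ∃ λ x → 0 < [D] (x ⊕ ⊖ 𝟙) * [D] x
    witness = sum-positive (λ x → [D] (x ⊕ ⊖ 𝟙) * [D] x) (subst (0 <_) (sym (shared-Residue≡1+r Residue-𝟙)) (s≤s z≤n))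
    x = proj₁ witness
    x-1∈D×x∈D : isResidue (x ⊕ ⊖ 𝟙) ≡ true × isResidue x ≡ true
    x-1∈D×x∈D = 𝕀*𝕀-positive (isResidue (x ⊕ ⊖ 𝟙)) (isResidue x) (proj₂ witness)
    x-[x-1]≡𝟙 : x ⊕ ⊖ (x ⊕ ⊖ 𝟙) ≡ 𝟙
    x-[x-1]≡𝟙 = solve 2 (λ x o → x :+ :- (x :+ :- o) := o) refl x 𝟙

  isAdesign : IsAdesign 2 ((p + 1) / 2) ((p ∸ 1) / 4) ((p ∸ 9) / 4) (points p) (blocksInfty p)
  isAdesign = record
    { numPoints   = numPoints
    ; blocksInP   = blocksInP
    ; blockSize   = blockSize
    ; twoValues   = twoValues
    ; lowerOccurs = lowerOccurs
    ; upperOccurs = upperOccurs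
    }

theorem4 : (p : ℕ) .{{_ : NonZero p}} → Prime p → p % 4 ≡ 1 → 5 < p →
    IsAdesign 2 ((p + 1) / 2) ((p ∸ 1) / 4) ((p ∸ 9) / 4) (points p) (blocksInfty p)
theorem4 p p-prime p%4≡1 5<p = PaleyAdesign.isAdesign p p-prime p%4≡1 5<p
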